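{- Let $m\geq 0$ and let $R_m$ be the ring of $m$-symmetric functions. For every $\ell\in\{1,\dots,m+1\}$, the family $$\{\, x^{\pmb a}\, m_\lambda(x_\ell,x_{\ell+1},x_{\ell+2},\dots)\ :\ \pmb a\in\mathbb Z_{\geq0}^m,\ \lambda \text{ a partition}\,\}$$ is a basis of $R_m$ (over $\mathbb Q(q,t)$). In particular (case $\ell=1$), $\{x^{\pmb a}\,m_\lambda(x_1,x_2,x_3,\dots)\}_{\pmb a,\lambda}$ is a basis of $R_m$.
   Context: $q,t$ are indeterminates. For $m\geq 0$, $R_m$ denotes the $\mathbb Q(q,t)$-algebra $\mathbb Q(q,t)[x_1,\dots,x_m]\otimes \mathbf\Lambda_m$, where $\mathbf\Lambda_m$ is the ring of symmetric functions in the variables $x_{m+1},x_{m+2},\dots$; equivalently, $R_m$ is the subring of $\mathbb Q(q,t)[[x_1,x_2,\dots]]$ of formal power series of bounded degree that are symmetric in $x_{m+1},x_{m+2},x_{m+3},\dots$ (no symmetry is required in $x_1,\dots,x_m$). For $\pmb a=(a_1,\dots,a_m)\in\mathbb Z_{\ge0}^m$, $x^{\pmb a}=x_1^{a_1}\cdots x_m^{a_m}$. For a partition $\lambda$, $m_\lambda(x_\ell,x_{\ell+1},\dots)$ is the monomial symmetric function in the variables $x_\ell,x_{\ell+1},\dots$. -}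

module Defs where

open import Data.Bool using (Bool; true; false; if_then_else_; _∧_)
open import Data.Nat using (ℕ; zero; suc; _+_; _∸_; _<_; _≤ᵇ_; _≡ᵇ_)
import Data.Nat as ℕ
open import Data.Rational using (ℚ; 0ℚ; 1ℚ)
import Data.Rational as ℚ
open import Data.Product using (_×_; _,_; ∃)
open import Data.List using (List; []; _∷_; [_]; _++_; map; concatMap; upTo; foldr; zipWith; reverse; dropWhile; take; drop; filterᵇ)
open import Data.Nat.ListAction using (sum)
open import Data.Bool.ListAction using (and)
import Data.List.Properties as LP
open import Data.List.Relation.Unary.All using (All)
open import Data.List.Relation.Unary.Linked using (Linked)
open import Data.List.Relation.Unary.Unique.Propositional using (Unique)
open import Data.Vec using (Vec; toList; tabulate; lookup)
open import Data.Fin using (Fin; toℕ)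
open import Data.Fin.Permutation using (Permutation′; _⟨$⟩ʳ_)
open import Relation.Binary.PropositionalEquality using (_≡_)
open import Relation.Nullary using (¬_; does)

-- The polynomial ring ℚ[q,t]: a polynomial is a finite formal sum of
-- terms c·q^i·t^j, given as a list of (c , i , j); two polynomials are
-- equal when all their coefficients agree.

Term : Set
Term = ℚ × ℕ × ℕ

Poly : Set
Poly = List Term

coeffP : Poly → ℕ → ℕ → ℚ
coeffP [] i j = 0ℚ
coeffP ((c , a , b) ∷ p) i j =
  if (a ≡ᵇ i) ∧ (b ≡ᵇ j) then c ℚ.+ coeffP p i j else coeffP p i j

_≈P_ : Poly → Poly → Set
p ≈P p' = ∀ i j → coeffP p i j ≡ coeffP p' i j

0P : Poly
0P = []

1P : Poly
1P = [ (1ℚ , 0 , 0) ]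

_+P_ : Poly → Poly → Poly
p +P p' = p ++ p'

_*P_ : Poly → Poly → Poly
p *P p' = concatMap (λ { (c , a , b) →
            map (λ { (c' , a' , b') → (c ℚ.* c' , a + a' , b + b') }) p' }) p

-- The field ℚ(q,t) of rational functions: pairs (numerator , denominator);
-- an element is valid when its denominator is a nonzero polynomial, and
-- n/d ≈ n'/d' iff n·d' = n'·d in ℚ[q,t].

QQ : Set
QQ = Poly × Poly

ValidQ : QQ → Set
ValidQ (n , d) = ¬ (d ≈P 0P)

_≈Q_ : QQ → QQ → Set
(n , d) ≈Q (n' , d') = (n *P d') ≈P (n' *P d)

0Q : QQ
0Q = (0P , 1P)

1Q : QQ
1Q = (1P , 1P)

_+Q_ : QQ → QQ → QQ
(n , d) +Q (n' , d') = ((n *P d') +P (n' *P d) , d *P d')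

_*Q_ : QQ → QQ → QQ
(n , d) *Q (n' , d') = (n *P n' , d *P d')

sumQ : List QQ → QQ
sumQ = foldr _+Q_ 0Q

-- A monomial x₁^{e₀} x₂^{e₁} ⋯ is a finite exponent list e (index i of
-- the list = exponent of x_{i+1}); trailing zeros are immaterial.

Mono : Set
Mono = List ℕ

Series : Set
Series = Mono → QQ

_≋_ : Series → Series → Set
f ≋ g = ∀ e → f e ≈Q g e

zeroS : Series
zeroS e = 0Q

below : Mono → List Mono
below [] = [ [] ]
below (n ∷ e) = concatMap (λ k → map (k ∷_) (below e)) (upTo (suc n))

_⊛_ : Series → Series → Series
(f ⊛ g) e = sumQ (map (λ e₁ → f e₁ *Q g (zipWith _∸_ e e₁)) (below e))

-- well-formedness of a coefficient function as a power series
-- (appending a zero exponent does not change the monomial) and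
-- validity of the coefficients in ℚ(q,t)
WellFormed : Series → Set
WellFormed f = (∀ e → f (e ++ [ 0 ]) ≈Q f e) × (∀ e → ValidQ (f e))

BoundedDegree : Series → Set
BoundedDegree f = ∃ λ d → ∀ e → d < sum e → f e ≈Q 0Q

permuteV : ∀ {N} → Permutation′ N → Vec ℕ N → Vec ℕ N
permuteV π e = tabulate (λ i → lookup e (π ⟨$⟩ʳ i))

SymmetricFrom : ℕ → Series → Set
SymmetricFrom m f =
  ∀ N (π : Permutation′ N) → (∀ i → toℕ i < m → π ⟨$⟩ʳ i ≡ i) →
  ∀ (e : Vec ℕ N) → f (toList (permuteV π e)) ≈Q f (toList e)

InR : ℕ → Series → Set
InR m f = WellFormed f × BoundedDegree f × SymmetricFrom m f

IsPartition : List ℕ → Set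
IsPartition λ′ = All (0 <_) λ′ × Linked ℕ._≥_ λ′

strip : Mono → Mono
strip e = reverse (dropWhile (ℕ._≟ 0) (reverse e))

insertDesc : ℕ → List ℕ → List ℕ
insertDesc x [] = [ x ]
insertDesc x (y ∷ ys) = if y ≤ᵇ x then x ∷ y ∷ ys else y ∷ insertDesc x ys

sortDesc : List ℕ → List ℕ
sortDesc = foldr insertDesc []

xpow : ∀ {m} → Vec ℕ m → Series
xpow a e = if does (LP.≡-dec ℕ._≟_ (strip e) (strip (toList a))) then 1Q else 0Q

monomialSym : ℕ → List ℕ → Series
monomialSym k λ′ e =
  if and (map (_≡ᵇ 0) (take k e))
     ∧ does (LP.≡-dec ℕ._≟_ (sortDesc (filterᵇ (λ n → 1 ≤ᵇ n) (drop k e))) λ′)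
  then 1Q else 0Q

-- the family x^a m_λ(x_ℓ, x_{ℓ+1}, …)   (ℓ ≥ 1, so k = ℓ − 1)
basisElem : ∀ m → ℕ → Vec ℕ m → List ℕ → Series
basisElem m ℓ a λ′ = xpow a ⊛ monomialSym (ℓ ∸ 1) λ′

LinComb : ℕ → Set
LinComb m = List (QQ × Vec ℕ m × List ℕ)

ValidComb : ∀ {m} → LinComb m → Set
ValidComb L = All (λ { (c , a , λ′) → ValidQ c × IsPartition λ′ }) L

evalComb : ∀ {m} → (Vec ℕ m → List ℕ → Series) → LinComb m → Series
evalComb B L e = sumQ (map (λ { (c , a , λ′) → c *Q B a λ′ e }) L)

indices : ∀ {m} → LinComb m → List (Vec ℕ m × List ℕ)
indices = map (λ { (c , a , λ′) → (a , λ′) })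

IsBasisR : ∀ m → (Vec ℕ m → List ℕ → Series) → Set
IsBasisR m B =
  (∀ a λ′ → IsPartition λ′ → InR m (B a λ′))
  × (∀ (L : LinComb m) → ValidComb L → Unique (indices L) →
       evalComb B L ≋ zeroS → All (λ { (c , _ , _) → c ≈Q 0Q }) L)
  × (∀ f → InR m f → ∃ λ (L : LinComb m) → ValidComb L × (f ≋ evalComb B L))

-- Every x^a m_λ(x_ℓ, …) takes only the values 0 and 1, and its value at a monomial depends only
-- on the first m exponents u and on the partition μ formed by the others. At the canonical
-- monomial x^u x_{m+1}^{μ₁} x_{m+2}^{μ₂} ⋯ the element of index (a, λ) vanishes unless
-- (a, λ) = (u, μ), where it is 1, or |λ| > |μ|: the family is unitriangular with respect to |λ|.
-- Independence follows by induction on |λ| from the top. An m-symmetric function is determined by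
-- its values at the canonical monomials of degree at most its own, so it is expanded by peeling
-- off one level of |λ| at a time. The rest is arithmetic in ℚ(q,t), presented as formal fractions
-- of polynomials: equality of fractions is transitive only because ℚ[q,t] has no zero divisors,
-- which is seen on lexicographically leading terms.

module Submission where

open import Defs
open import Algebra.Bundles using (CommutativeRing)
import Algebra.Properties.CommutativeMonoid.Sum as CommutativeMonoidSum
open import Algebra.Solver.Ring.AlmostCommutativeRing
  using (fromCommutativeRing; _-Raw-AlmostCommutative⟶_)
import Algebra.Solver.Ring as RingSolver
open import Data.Bool using (Bool; true; false; if_then_else_; _∧_; _∨_; T)
open import Data.Bool.ListAction using (and; or)
import Data.Bool.Properties as BoolP
open import Data.Empty using (⊥; ⊥-elim)
open import Data.Fin using (Fin; toℕ) renaming (zero to fzero; suc to fsuc)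
open import Data.Fin.Permutation using (Permutation′; _⟨$⟩ʳ_; lift₀; transpose)
open import Data.List
  using (List; []; _∷_; [_]; _++_; map; concatMap; upTo; downFrom; foldr; length; reverse;
         dropWhile; replicate; zipWith; take; drop; filter; filterᵇ; deduplicate; cartesianProduct)
import Data.List.Properties as LP
open import Data.List.Membership.Propositional using (_∈_)
import Data.List.Membership.Propositional.Properties as MP
open import Data.List.Relation.Binary.Permutation.Propositional as ↭ using (_↭_; ↭-sym)
import Data.List.Relation.Binary.Permutation.Propositional.Properties as ↭P
open import Data.List.Relation.Unary.All as All using (All; []; _∷_; all?)
import Data.List.Relation.Unary.All.Properties as AllP
open import Data.List.Relation.Unary.AllPairs using (AllPairs; []; _∷_)
open import Data.List.Relation.Unary.Any as Any using (Any; here; there; any?)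
open import Data.List.Relation.Unary.Linked using (Linked; []; [-]; _∷_; linked?)
open import Data.List.Relation.Unary.Unique.Propositional using (Unique)
import Data.List.Relation.Unary.Unique.DecPropositional.Properties as UniqueDecP
import Data.List.Relation.Unary.Unique.Propositional.Properties as UniqueP
open import Data.Maybe using (Maybe; nothing; just)
open import Data.Nat
  using (ℕ; zero; suc; _+_; _∸_; _<_; _≤_; _≥_; _≡ᵇ_; _≤ᵇ_; _<ᵇ_; s≤s; z≤n)
import Data.Nat as ℕ
open import Data.Nat.ListAction using (sum)
import Data.Nat.ListAction.Properties as SumP
import Data.Nat.Properties as ℕP
open import Algebra.Properties.CommutativeSemigroup ℕP.+-commutativeSemigroup
  using () renaming (interchange to +-interchange)
open import Data.Product using (_×_; _,_; proj₁; proj₂; Σ; ∃)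
import Data.Product.Properties as ProdP
open import Data.Rational using (ℚ; 0ℚ; 1ℚ; _*_; -_; 1/_) renaming (_+_ to _+ℚ_)
import Data.Rational as ℚ
import Data.Rational.Properties as ℚP
open import Data.Rational.Solver using (module +-*-Solver)
open import Data.Sum using (_⊎_; inj₁; inj₂; [_,_]′)
open import Data.Unit using (tt)
open import Data.Vec using (Vec; toList; fromList; lookup)
  renaming ([] to []v; _∷_ to _∷v_; _++_ to _++v_)
import Data.Vec.Properties as VecP
open import Function using (_∘_)
open import Level using (0ℓ)
open import Relation.Binary.Definitions using (tri<; tri≈; tri>)
open import Relation.Binary.PropositionalEquality
  using (_≡_; _≢_; refl; sym; trans; cong; cong₂; subst; module ≡-Reasoning)
open import Relation.Binary.Structures using (IsEquivalence)
open import Relation.Nullary using (¬_; Dec; yes; no; does; _×-dec_; ¬?)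

∑[_]_ : ∀ {A : Set} → List A → (A → ℚ) → ℚ
∑[ xs ] f = foldr _+ℚ_ 0ℚ (map f xs)

module ListSums where

  ∑-cong : ∀ {A : Set} (xs : List A) {f g : A → ℚ} → (∀ x → f x ≡ g x) → ∑[ xs ] f ≡ ∑[ xs ] g
  ∑-cong [] e = refl
  ∑-cong (x ∷ xs) e = cong₂ _+ℚ_ (e x) (∑-cong xs e)

  ∑-zero : ∀ {A : Set} (xs : List A) → ∑[ xs ] (λ _ → 0ℚ) ≡ 0ℚ
  ∑-zero [] = refl
  ∑-zero (x ∷ xs) rewrite ∑-zero xs = refl

  ∑-if : ∀ {A : Set} (xs : List A) (c : Bool) (f : A → ℚ) →
    ∑[ xs ] (λ x → if c then f x else 0ℚ) ≡ (if c then ∑[ xs ] f else 0ℚ)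
  ∑-if xs true f = refl
  ∑-if xs false f = ∑-zero xs

open ListSums

-- A polynomial p pairs with a coefficient functional g : ℕ → ℕ → ℚ to ∑ c·g(i,j) over its terms
-- (c , i , j); coefficient extraction is pairing with a Kronecker delta, and ℚ[q,t] gets its
-- ring laws by transporting those of ℚ through the pairing.
pairing : Poly → (ℕ → ℕ → ℚ) → ℚ
pairing [] g = 0ℚ
pairing ((c , a , b) ∷ p) g = c * g a b +ℚ pairing p g

module Pairing where
  open +-*-Solver

  shiftTerm : Term → Term → Term
  shiftTerm (c , a , b) (c' , a' , b') = (c * c' , a + a' , b + b')

  pairing-cong : ∀ p {g h : ℕ → ℕ → ℚ} → (∀ a b → g a b ≡ h a b) → pairing p g ≡ pairing p h
  pairing-cong [] e = refl
  pairing-cong ((c , a , b) ∷ p) e = cong₂ (λ u v → c * u +ℚ v) (e a b) (pairing-cong p e)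

  pairing-++ : ∀ p q g → pairing (p ++ q) g ≡ pairing p g +ℚ pairing q g
  pairing-++ [] q g = sym (ℚP.+-identityˡ _)
  pairing-++ ((c , a , b) ∷ p) q g rewrite pairing-++ p q g =
    sym (ℚP.+-assoc (c * g a b) (pairing p g) (pairing q g))

  pairing-+ : ∀ p g h → pairing p (λ a b → g a b +ℚ h a b) ≡ pairing p g +ℚ pairing p h
  pairing-+ [] g h = refl
  pairing-+ ((c , a , b) ∷ p) g h rewrite pairing-+ p g h =
    solve 5 (λ c x y u v → c :* (x :+ y) :+ (u :+ v) := (c :* x :+ u) :+ (c :* y :+ v)) refl
      c (g a b) (h a b) (pairing p g) (pairing p h)

  pairing-*ˡ : ∀ p k g → pairing p (λ a b → k * g a b) ≡ k * pairing p g
  pairing-*ˡ [] k g = sym (ℚP.*-zeroʳ k)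
  pairing-*ˡ ((c , a , b) ∷ p) k g rewrite pairing-*ˡ p k g =
    solve 4 (λ c k x u → c :* (k :* x) :+ k :* u := k :* (c :* x :+ u)) refl c k (g a b) (pairing p g)

  pairing-*ʳ : ∀ p g k → pairing p (λ a b → g a b * k) ≡ pairing p g * k
  pairing-*ʳ p g k = trans (pairing-cong p (λ a b → ℚP.*-comm (g a b) k))
    (trans (pairing-*ˡ p k g) (ℚP.*-comm k (pairing p g)))

  pairing-zero : ∀ p → pairing p (λ _ _ → 0ℚ) ≡ 0ℚ
  pairing-zero [] = refl
  pairing-zero ((c , a , b) ∷ p) rewrite pairing-zero p | ℚP.*-zeroʳ c = refl

  pairing-∑ : ∀ {A : Set} p (xs : List A) (F : A → ℕ → ℕ → ℚ) →
    pairing p (λ a b → ∑[ xs ] (λ x → F x a b)) ≡ ∑[ xs ] (λ x → pairing p (F x))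
  pairing-∑ p [] F = pairing-zero p
  pairing-∑ p (x ∷ xs) F = trans (pairing-+ p (F x) (λ a b → ∑[ xs ] (λ x → F x a b)))
    (cong (pairing p (F x) +ℚ_) (pairing-∑ p xs F))

  pairing-swap : ∀ p q (F : ℕ → ℕ → ℕ → ℕ → ℚ) →
    pairing p (λ a b → pairing q (F a b)) ≡ pairing q (λ a' b' → pairing p (λ a b → F a b a' b'))
  pairing-swap [] q F = sym (pairing-zero q)
  pairing-swap ((c , a , b) ∷ p) q F rewrite pairing-swap p q F =
    sym (trans (pairing-+ q (λ a' b' → c * F a b a' b') (λ a' b' → pairing p (λ a b → F a b a' b')))
               (cong (_+ℚ pairing q (λ a' b' → pairing p (λ a b → F a b a' b'))) (pairing-*ˡ q c (F a b))))

  pairing-shift : ∀ c a b q g →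
    pairing (map (shiftTerm (c , a , b)) q) g ≡ c * pairing q (λ a' b' → g (a + a') (b + b'))
  pairing-shift c a b [] g = sym (ℚP.*-zeroʳ c)
  pairing-shift c a b ((c' , a' , b') ∷ q) g rewrite pairing-shift c a b q g =
    solve 4 (λ c c' x u → c :* c' :* x :+ c :* u := c :* (c' :* x :+ u)) refl
      c c' (g (a + a') (b + b')) (pairing q (λ a' b' → g (a + a') (b + b')))

  pairing-*P : ∀ p q g →
    pairing (p *P q) g ≡ pairing p (λ a b → pairing q (λ a' b' → g (a + a') (b + b')))
  pairing-*P [] q g = refl
  pairing-*P ((c , a , b) ∷ p) q g =
    trans (pairing-++ (map (shiftTerm (c , a , b)) q) (p *P q) g)
          (cong₂ _+ℚ_ (pairing-shift c a b q g) (pairing-*P p q g))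

open Pairing

δ : ℕ → ℕ → ℕ → ℕ → ℚ
δ i j a b = if (a ≡ᵇ i) ∧ (b ≡ᵇ j) then 1ℚ else 0ℚ

≡ᵇ-refl : ∀ n → (n ≡ᵇ n) ≡ true
≡ᵇ-refl zero = refl
≡ᵇ-refl (suc n) = ≡ᵇ-refl n

≡ᵇ-true⇒≡ : ∀ m n → (m ≡ᵇ n) ≡ true → m ≡ n
≡ᵇ-true⇒≡ m n e = ℕP.≡ᵇ⇒≡ m n (subst T (sym e) tt)

>⇒≡ᵇ-false : ∀ m n → n < m → (m ≡ᵇ n) ≡ false
>⇒≡ᵇ-false (suc m) zero _ = refl
>⇒≡ᵇ-false (suc m) (suc n) (s≤s p) = >⇒≡ᵇ-false m n p

<⇒≡ᵇ-false : ∀ m n → m < n → (m ≡ᵇ n) ≡ false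
<⇒≡ᵇ-false zero (suc n) _ = refl
<⇒≡ᵇ-false (suc m) (suc n) (s≤s p) = <⇒≡ᵇ-false m n p

module CoefficientGrid where

  coeffP≡pairing-δ : ∀ p i j → coeffP p i j ≡ pairing p (δ i j)
  coeffP≡pairing-δ [] i j = refl
  coeffP≡pairing-δ ((c , a , b) ∷ p) i j with (a ≡ᵇ i) ∧ (b ≡ᵇ j)
  ... | true rewrite ℚP.*-identityʳ c = cong (c +ℚ_) (coeffP≡pairing-δ p i j)
  ... | false rewrite ℚP.*-zeroʳ c | ℚP.+-identityˡ (pairing p (δ i j)) = coeffP≡pairing-δ p i j

  ∑-downFrom-select-absent : ∀ a n (h : ℕ → ℚ) → n ≤ a →
    ∑[ downFrom n ] (λ a' → if a ≡ᵇ a' then h a' else 0ℚ) ≡ 0ℚ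
  ∑-downFrom-select-absent a zero h _ = refl
  ∑-downFrom-select-absent a (suc n) h le
    rewrite >⇒≡ᵇ-false a n le | ∑-downFrom-select-absent a n h (ℕP.≤-trans (ℕP.n≤1+n n) le) = refl

  ∑-downFrom-select : ∀ a n (h : ℕ → ℚ) → a < n →
    ∑[ downFrom n ] (λ a' → if a ≡ᵇ a' then h a' else 0ℚ) ≡ h a
  ∑-downFrom-select a (suc n) h (s≤s le) with ℕP.m≤n⇒m<n∨m≡n le
  ... | inj₁ lt rewrite <⇒≡ᵇ-false a n lt | ∑-downFrom-select a n h lt = ℚP.+-identityˡ (h a)
  ... | inj₂ refl rewrite ≡ᵇ-refl a | ∑-downFrom-select-absent a a h ℕP.≤-refl = ℚP.+-identityʳ (h a)

  δ-*ˡ : ∀ a b i j (x : ℚ) →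
    δ i j a b * x ≡ (if a ≡ᵇ i then (if b ≡ᵇ j then x else 0ℚ) else 0ℚ)
  δ-*ˡ a b i j x with a ≡ᵇ i | b ≡ᵇ j
  ... | true | true = ℚP.*-identityˡ x
  ... | true | false = ℚP.*-zeroˡ x
  ... | false | _ = ℚP.*-zeroˡ x

  ∑∑-downFrom-δ : ∀ N a b (g : ℕ → ℕ → ℚ) → a < N → b < N →
    ∑[ downFrom N ] (λ i → ∑[ downFrom N ] (λ j → δ i j a b * g i j)) ≡ g a b
  ∑∑-downFrom-δ N a b g a<N b<N =
    trans (∑-cong (downFrom N) (λ i →
             trans (∑-cong (downFrom N) (λ j → δ-*ˡ a b i j (g i j)))
                   (∑-if (downFrom N) (a ≡ᵇ i) (λ j → if b ≡ᵇ j then g i j else 0ℚ))))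
     (trans (∑-downFrom-select a N (λ i → ∑[ downFrom N ] (λ j → if b ≡ᵇ j then g i j else 0ℚ)) a<N)
            (∑-downFrom-select b N (g a) b<N))

  ExponentsBelow : Poly → ℕ → Set
  ExponentsBelow p N = All (λ t → proj₁ (proj₂ t) < N × proj₂ (proj₂ t) < N) p

  exponentBound : Poly → ℕ
  exponentBound [] = 0
  exponentBound ((c , a , b) ∷ p) = suc (a + b) + exponentBound p

  exponentsBelow-mono : ∀ p {N M} → N ≤ M → ExponentsBelow p N → ExponentsBelow p M
  exponentsBelow-mono [] le B = []
  exponentsBelow-mono (t ∷ p) le ((x , y) ∷ B) =
    (ℕP.<-≤-trans x le , ℕP.<-≤-trans y le) ∷ exponentsBelow-mono p le B

  exponentsBelow-bound : ∀ p → ExponentsBelow p (exponentBound p)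
  exponentsBelow-bound [] = []
  exponentsBelow-bound ((c , a , b) ∷ p) =
    ( s≤s (ℕP.≤-trans (ℕP.m≤m+n a b) (ℕP.m≤m+n (a + b) (exponentBound p)))
    , s≤s (ℕP.≤-trans (ℕP.m≤n+m b a) (ℕP.m≤m+n (a + b) (exponentBound p))))
    ∷ exponentsBelow-mono p (ℕP.m≤n+m (exponentBound p) (suc (a + b))) (exponentsBelow-bound p)

  exponentsBelow-+ˡ : ∀ p q → ExponentsBelow p (exponentBound p + exponentBound q)
  exponentsBelow-+ˡ p q = exponentsBelow-mono p (ℕP.m≤m+n _ _) (exponentsBelow-bound p)

  exponentsBelow-+ʳ : ∀ p q → ExponentsBelow q (exponentBound p + exponentBound q)
  exponentsBelow-+ʳ p q = exponentsBelow-mono q (ℕP.m≤n+m _ _) (exponentsBelow-bound q)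

  pairing-cong-below : ∀ p N {g h : ℕ → ℕ → ℚ} → ExponentsBelow p N →
    (∀ a b → a < N → b < N → g a b ≡ h a b) → pairing p g ≡ pairing p h
  pairing-cong-below [] N B e = refl
  pairing-cong-below ((c , a , b) ∷ p) N ((a< , b<) ∷ B) e =
    cong₂ (λ u v → c * u +ℚ v) (e a b a< b<) (pairing-cong-below p N B e)

  pairing≡∑coeffP : ∀ p N g → ExponentsBelow p N →
    pairing p g ≡ ∑[ downFrom N ] (λ i → ∑[ downFrom N ] (λ j → coeffP p i j * g i j))
  pairing≡∑coeffP p N g B =
    trans (pairing-cong-below p N B (λ a b a< b< → sym (∑∑-downFrom-δ N a b g a< b<)))
    (trans (pairing-∑ p (downFrom N) (λ i a b → ∑[ downFrom N ] (λ j → δ i j a b * g i j)))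
    (∑-cong (downFrom N) (λ i → trans (pairing-∑ p (downFrom N) (λ j a b → δ i j a b * g i j))
       (∑-cong (downFrom N) (λ j → trans (pairing-*ʳ p (δ i j) (g i j))
                                         (cong (_* g i j) (sym (coeffP≡pairing-δ p i j))))))))

  ≈P⇒pairing≡ : ∀ p q → p ≈P q → ∀ g → pairing p g ≡ pairing q g
  ≈P⇒pairing≡ p q e g =
    trans (pairing≡∑coeffP p N g (exponentsBelow-+ˡ p q))
    (trans (∑-cong (downFrom N) (λ i → ∑-cong (downFrom N) (λ j → cong (_* g i j) (e i j))))
           (sym (pairing≡∑coeffP q N g (exponentsBelow-+ʳ p q))))
    where N = exponentBound p + exponentBound q

  pairing≡⇒≈P : ∀ p q → (∀ g → pairing p g ≡ pairing q g) → p ≈P q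
  pairing≡⇒≈P p q e i j =
    trans (coeffP≡pairing-δ p i j) (trans (e (δ i j)) (sym (coeffP≡pairing-δ q i j)))

open CoefficientGrid

module PolynomialRing where
  open +-*-Solver

  negP : Poly → Poly
  negP = map (λ { (c , a , b) → (- c , a , b) })

  pairing-negP : ∀ p g → pairing (negP p) g ≡ - pairing p g
  pairing-negP [] g = refl
  pairing-negP ((c , a , b) ∷ p) g rewrite pairing-negP p g =
    solve 3 (λ c x u → (:- c) :* x :+ (:- u) := :- (c :* x :+ u)) refl c (g a b) (pairing p g)

  ≈P-isEquivalence : IsEquivalence _≈P_
  ≈P-isEquivalence = record
    { refl = λ i j → refl ; sym = λ e i j → sym (e i j) ; trans = λ e f i j → trans (e i j) (f i j) }

  +P-cong : ∀ {p p' q q'} → p ≈P p' → q ≈P q' → (p +P q) ≈P (p' +P q')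
  +P-cong {p} {p'} {q} {q'} e f = pairing≡⇒≈P (p +P q) (p' +P q') λ g → begin
    pairing (p ++ q) g             ≡⟨ pairing-++ p q g ⟩
    pairing p g +ℚ pairing q g     ≡⟨ cong₂ _+ℚ_ (≈P⇒pairing≡ p p' e g) (≈P⇒pairing≡ q q' f g) ⟩
    pairing p' g +ℚ pairing q' g   ≡⟨ pairing-++ p' q' g ⟨
    pairing (p' ++ q') g           ∎
    where open ≡-Reasoning

  *P-cong : ∀ {p p' q q'} → p ≈P p' → q ≈P q' → (p *P q) ≈P (p' *P q')
  *P-cong {p} {p'} {q} {q'} e f = pairing≡⇒≈P (p *P q) (p' *P q') λ g →
    trans (pairing-*P p q g)
    (trans (≈P⇒pairing≡ p p' e _)
    (trans (pairing-cong p' (λ a b → ≈P⇒pairing≡ q q' f _)) (sym (pairing-*P p' q' g))))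

  negP-cong : ∀ {p p'} → p ≈P p' → negP p ≈P negP p'
  negP-cong {p} {p'} e = pairing≡⇒≈P (negP p) (negP p') λ g →
    trans (pairing-negP p g) (trans (cong -_ (≈P⇒pairing≡ p p' e g)) (sym (pairing-negP p' g)))

  +P-assoc : ∀ p q r → ((p +P q) +P r) ≈P (p +P (q +P r))
  +P-assoc p q r = pairing≡⇒≈P ((p +P q) +P r) (p +P (q +P r)) λ g → begin
    pairing ((p ++ q) ++ r) g                      ≡⟨ pairing-++ (p ++ q) r g ⟩
    pairing (p ++ q) g +ℚ pairing r g              ≡⟨ cong (_+ℚ pairing r g) (pairing-++ p q g) ⟩
    (pairing p g +ℚ pairing q g) +ℚ pairing r g    ≡⟨ ℚP.+-assoc (pairing p g) (pairing q g) (pairing r g) ⟩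
    pairing p g +ℚ (pairing q g +ℚ pairing r g)    ≡⟨ cong (pairing p g +ℚ_) (pairing-++ q r g) ⟨
    pairing p g +ℚ pairing (q ++ r) g              ≡⟨ pairing-++ p (q ++ r) g ⟨
    pairing (p ++ (q ++ r)) g                      ∎
    where open ≡-Reasoning

  +P-comm : ∀ p q → (p +P q) ≈P (q +P p)
  +P-comm p q = pairing≡⇒≈P (p +P q) (q +P p) λ g →
    trans (pairing-++ p q g) (trans (ℚP.+-comm (pairing p g) (pairing q g)) (sym (pairing-++ q p g)))

  +P-identityʳ : ∀ p → (p +P 0P) ≈P p
  +P-identityʳ p = pairing≡⇒≈P (p +P 0P) p λ g → trans (pairing-++ p [] g) (ℚP.+-identityʳ (pairing p g))

  negP-inverseˡ : ∀ p → (negP p +P p) ≈P 0P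
  negP-inverseˡ p = pairing≡⇒≈P (negP p +P p) 0P λ g →
    trans (pairing-++ (negP p) p g)
          (trans (cong (_+ℚ pairing p g) (pairing-negP p g)) (ℚP.+-inverseˡ (pairing p g)))

  negP-inverseʳ : ∀ p → (p +P negP p) ≈P 0P
  negP-inverseʳ p = pairing≡⇒≈P (p +P negP p) 0P λ g →
    trans (pairing-++ p (negP p) g)
          (trans (cong (pairing p g +ℚ_) (pairing-negP p g)) (ℚP.+-inverseʳ (pairing p g)))

  *P-assoc : ∀ p q r → ((p *P q) *P r) ≈P (p *P (q *P r))
  *P-assoc p q r = pairing≡⇒≈P ((p *P q) *P r) (p *P (q *P r)) λ g →
    trans (pairing-*P (p *P q) r g) (trans (pairing-*P p q _)
    (sym (trans (pairing-*P p (q *P r) g) (pairing-cong p (λ a b → trans (pairing-*P q r _)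
       (pairing-cong q (λ a' b' → pairing-cong r (λ a'' b'' →
         sym (cong₂ g (ℕP.+-assoc a a' a'') (ℕP.+-assoc b b' b''))))))))))

  *P-comm : ∀ p q → (p *P q) ≈P (q *P p)
  *P-comm p q = pairing≡⇒≈P (p *P q) (q *P p) λ g →
    trans (pairing-*P p q g) (trans (pairing-swap p q _)
    (trans (pairing-cong q (λ a' b' → pairing-cong p (λ a b → cong₂ g (ℕP.+-comm a a') (ℕP.+-comm b b'))))
           (sym (pairing-*P q p g))))

  *P-identityˡ : ∀ p → (1P *P p) ≈P p
  *P-identityˡ p = pairing≡⇒≈P (1P *P p) p λ g →
    trans (pairing-*P 1P p g) (trans (ℚP.+-identityʳ _) (ℚP.*-identityˡ _))

  *P-identityʳ : ∀ p → (p *P 1P) ≈P p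
  *P-identityʳ p = pairing≡⇒≈P (p *P 1P) p λ g → trans (pairing-*P p 1P g) (pairing-cong p (λ a b →
     trans (ℚP.+-identityʳ _) (trans (ℚP.*-identityˡ _) (cong₂ g (ℕP.+-identityʳ a) (ℕP.+-identityʳ b)))))

  *P-distribˡ-+P : ∀ p q r → (p *P (q +P r)) ≈P ((p *P q) +P (p *P r))
  *P-distribˡ-+P p q r = pairing≡⇒≈P (p *P (q +P r)) ((p *P q) +P (p *P r)) λ g →
    trans (pairing-*P p (q ++ r) g) (trans (pairing-cong p (λ a b → pairing-++ q r _))
    (trans (pairing-+ p _ _)
    (sym (trans (pairing-++ (p *P q) (p *P r) g) (cong₂ _+ℚ_ (pairing-*P p q g) (pairing-*P p r g))))))

  *P-distribʳ-+P : ∀ p q r → ((q +P r) *P p) ≈P ((q *P p) +P (r *P p))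
  *P-distribʳ-+P p q r = pairing≡⇒≈P ((q +P r) *P p) ((q *P p) +P (r *P p)) λ g →
    trans (pairing-*P (q ++ r) p g) (trans (pairing-++ q r _)
    (sym (trans (pairing-++ (q *P p) (r *P p) g) (cong₂ _+ℚ_ (pairing-*P q p g) (pairing-*P r p g)))))

  polynomialRing : CommutativeRing 0ℓ 0ℓ
  polynomialRing = record
    { Carrier = Poly ; _≈_ = _≈P_ ; _+_ = _+P_ ; _*_ = _*P_ ; -_ = negP ; 0# = 0P ; 1# = 1P
    ; isCommutativeRing = record
      { isRing = record
        { +-isAbelianGroup = record
          { isGroup = record
            { isMonoid = record
              { isSemigroup = record
                { isMagma = record
                  { isEquivalence = ≈P-isEquivalence
                  ; ∙-cong = λ {x} {y} {u} {v} → +P-cong {x} {y} {u} {v} }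
                ; assoc = +P-assoc }
              ; identity = (λ p i j → refl) , +P-identityʳ }
            ; inverse = negP-inverseˡ , negP-inverseʳ
            ; ⁻¹-cong = λ {x} {y} → negP-cong {x} {y} }
          ; comm = +P-comm }
        ; *-cong = λ {x} {y} {u} {v} → *P-cong {x} {y} {u} {v}
        ; *-assoc = *P-assoc
        ; *-identity = *P-identityˡ , *P-identityʳ
        ; distrib = *P-distribˡ-+P , *P-distribʳ-+P }
      ; *-comm = *P-comm } }

open PolynomialRing

module IntegralDomain where

  ℚ-noZeroDivisors : ∀ x y → x ≢ 0ℚ → y ≢ 0ℚ → x * y ≢ 0ℚ
  ℚ-noZeroDivisors x y x≢0 y≢0 xy≡0 = y≢0 (begin
      y             ≡⟨ ℚP.*-identityˡ y ⟨
      1ℚ * y        ≡⟨ cong (_* y) (ℚP.*-inverseˡ x {{ℚ.≢-nonZero x≢0}}) ⟨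
      (x⁻¹ * x) * y ≡⟨ ℚP.*-assoc x⁻¹ x y ⟩
      x⁻¹ * (x * y) ≡⟨ cong (x⁻¹ *_) xy≡0 ⟩
      x⁻¹ * 0ℚ      ≡⟨ ℚP.*-zeroʳ x⁻¹ ⟩
      0ℚ            ∎)
    where open ≡-Reasoning
          x⁻¹ = (1/ x) {{ℚ.≢-nonZero x≢0}}

  _≟²_ : (x y : ℕ × ℕ) → Dec (x ≡ y)
  _≟²_ = ProdP.≡-dec ℕ._≟_ ℕ._≟_

  δ-diag : ∀ i j → δ i j i j ≡ 1ℚ
  δ-diag i j rewrite ≡ᵇ-refl i | ≡ᵇ-refl j = refl

  δ-off : ∀ i j a b → (a , b) ≢ (i , j) → δ i j a b ≡ 0ℚ
  δ-off i j a b ne with a ≡ᵇ i in e₁ | b ≡ᵇ j in e₂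
  ... | true | true = ⊥-elim (ne (cong₂ _,_ (≡ᵇ-true⇒≡ a i e₁) (≡ᵇ-true⇒≡ b j e₂)))
  ... | true | false = refl
  ... | false | _ = refl

  exponents : Poly → List (ℕ × ℕ)
  exponents = map (λ t → proj₁ (proj₂ t) , proj₂ (proj₂ t))

  coeffP≢0⇒∈exponents : ∀ p a b → coeffP p a b ≢ 0ℚ → (a , b) ∈ exponents p
  coeffP≢0⇒∈exponents [] a b ne = ⊥-elim (ne refl)
  coeffP≢0⇒∈exponents ((c , a' , b') ∷ p) a b ne with a' ≡ᵇ a in e₁ | b' ≡ᵇ b in e₂
  ... | true | true rewrite ≡ᵇ-true⇒≡ a' a e₁ | ≡ᵇ-true⇒≡ b' b e₂ = here refl
  ... | true | false = there (coeffP≢0⇒∈exponents p a b ne)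
  ... | false | _ = there (coeffP≢0⇒∈exponents p a b ne)

  ∈exponents⇒below : ∀ p N {a b} → ExponentsBelow p N → (a , b) ∈ exponents p → a < N × b < N
  ∈exponents⇒below (t ∷ p) N (x ∷ B) (here refl) = x
  ∈exponents⇒below (t ∷ p) N (x ∷ B) (there m) = ∈exponents⇒below p N B m

  _≤ₗₑₓ_ : ℕ × ℕ → ℕ × ℕ → Set
  (a , b) ≤ₗₑₓ (a' , b') = a < a' ⊎ (a ≡ a' × b ≤ b')

  ≤ₗₑₓ-total : ∀ x y → x ≤ₗₑₓ y ⊎ y ≤ₗₑₓ x
  ≤ₗₑₓ-total (a , b) (a' , b') with ℕP.<-cmp a a'
  ... | tri< lt _ _ = inj₁ (inj₁ lt)
  ... | tri> _ _ gt = inj₂ (inj₁ gt)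
  ... | tri≈ _ refl _ with ℕP.≤-total b b'
  ...   | inj₁ le = inj₁ (inj₂ (refl , le))
  ...   | inj₂ le = inj₂ (inj₂ (refl , le))

  ≤ₗₑₓ-trans : ∀ x y z → x ≤ₗₑₓ y → y ≤ₗₑₓ z → x ≤ₗₑₓ z
  ≤ₗₑₓ-trans _ _ _ (inj₁ p) (inj₁ q) = inj₁ (ℕP.<-trans p q)
  ≤ₗₑₓ-trans _ _ _ (inj₁ p) (inj₂ (refl , _)) = inj₁ p
  ≤ₗₑₓ-trans _ _ _ (inj₂ (refl , _)) (inj₁ q) = inj₁ q
  ≤ₗₑₓ-trans _ _ _ (inj₂ (refl , p)) (inj₂ (refl , q)) = inj₂ (refl , ℕP.≤-trans p q)

  ≤ₗₑₓ-refl : ∀ x → x ≤ₗₑₓ x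
  ≤ₗₑₓ-refl x = inj₂ (refl , ℕP.≤-refl)

  ≤ₗₑₓ⇒≤ : ∀ {a b a' b'} → (a , b) ≤ₗₑₓ (a' , b') → a ≤ a'
  ≤ₗₑₓ⇒≤ (inj₁ lt) = ℕP.<⇒≤ lt
  ≤ₗₑₓ⇒≤ (inj₂ (refl , _)) = ℕP.≤-refl

  ≤-+-cancel : ∀ {i A i' A'} → i ≤ A → i' ≤ A' → i + i' ≡ A + A' → i ≡ A × i' ≡ A'
  ≤-+-cancel {i} {A} {i'} {A'} le le' e with ℕP.m≤n⇒m<n∨m≡n le
  ... | inj₁ lt = ⊥-elim (ℕP.<⇒≢ (ℕP.+-mono-<-≤ lt le') e)
  ... | inj₂ refl = refl , ℕP.+-cancelˡ-≡ i i' A' e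

  ≤ₗₑₓ-+-cancel : ∀ {i j A B i' j' A' B'} → (i , j) ≤ₗₑₓ (A , B) → (i' , j') ≤ₗₑₓ (A' , B') →
    (i + i' , j + j') ≡ (A + A' , B + B') → (i , j) ≡ (A , B) × (i' , j') ≡ (A' , B')
  ≤ₗₑₓ-+-cancel l₁ l₂ e with ≤-+-cancel (≤ₗₑₓ⇒≤ l₁) (≤ₗₑₓ⇒≤ l₂) (cong proj₁ e)
  ... | refl , refl with l₁ | l₂
  ...   | inj₁ lt | _ = ⊥-elim (ℕP.<-irrefl refl lt)
  ...   | inj₂ _ | inj₁ lt = ⊥-elim (ℕP.<-irrefl refl lt)
  ...   | inj₂ (_ , b₁) | inj₂ (_ , b₂) with ≤-+-cancel b₁ b₂ (cong proj₂ e)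
  ...     | refl , refl = refl , refl

  lexMax : ∀ {P : ℕ × ℕ → Set} → (∀ x → Dec (P x)) → ∀ xs → Any P xs →
    Σ (ℕ × ℕ) λ m → m ∈ xs × P m × (∀ y → y ∈ xs → P y → y ≤ₗₑₓ m)
  lexMax P? (x ∷ xs) anyP with P? x | any? P? xs
  ... | no ¬px | no ¬any = ⊥-elim ([ ¬px , ¬any ]′ (Any.toSum anyP))
  ... | no ¬px | yes a with lexMax P? xs a
  ...   | m , m∈ , pm , mx =
          m , there m∈ , pm , λ { y (here refl) py → ⊥-elim (¬px py) ; y (there y∈) py → mx y y∈ py }
  lexMax P? (x ∷ xs) anyP | yes px | no ¬any =
    x , here refl , px , λ { y (here refl) py → ≤ₗₑₓ-refl y
                           ; y (there y∈) py → ⊥-elim (¬any (Any.map (λ { refl → py }) y∈)) }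
  lexMax P? (x ∷ xs) anyP | yes px | yes a with lexMax P? xs a
  ... | m , m∈ , pm , mx with ≤ₗₑₓ-total x m
  ...   | inj₁ x≤m = m , there m∈ , pm , λ { y (here refl) py → x≤m ; y (there y∈) py → mx y y∈ py }
  ...   | inj₂ m≤x = x , here refl , px ,
          λ { y (here refl) py → ≤ₗₑₓ-refl y ; y (there y∈) py → ≤ₗₑₓ-trans y m x (mx y y∈ py) m≤x }

  record LeadingTerm (p : Poly) : Set where
    field
      i j : ℕ
      ∈exponents : (i , j) ∈ exponents p
      nonzero : coeffP p i j ≢ 0ℚ
      maximal : ∀ a b → coeffP p a b ≢ 0ℚ → (a , b) ≤ₗₑₓ (i , j)

  leadingTerm : ∀ p → ¬ (p ≈P 0P) → LeadingTerm p
  leadingTerm p p≉0 with lexMax (λ x → ¬? (coeffP p (proj₁ x) (proj₂ x) ℚP.≟ 0ℚ)) (exponents p) someNonzero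
    where
    someNonzero : Any (λ x → coeffP p (proj₁ x) (proj₂ x) ≢ 0ℚ) (exponents p)
    someNonzero with any? (λ x → ¬? (coeffP p (proj₁ x) (proj₂ x) ℚP.≟ 0ℚ)) (exponents p)
    ... | yes a = a
    ... | no none = ⊥-elim (p≉0 λ a b → ≡0 a b)
      where
      ≡0 : ∀ a b → coeffP p a b ≡ 0ℚ
      ≡0 a b with coeffP p a b ℚP.≟ 0ℚ
      ... | yes z = z
      ... | no nz = ⊥-elim (none (Any.map (λ { refl → nz }) (coeffP≢0⇒∈exponents p a b nz)))
  ... | (a , b) , m∈ , pm , mx = record
    { i = a ; j = b ; ∈exponents = m∈ ; nonzero = pm
    ; maximal = λ a' b' ne → mx (a' , b') (coeffP≢0⇒∈exponents p a' b' ne) ne }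

  -- The coefficient of p·q at the sum of the lexicographically leading exponents is the
  -- product of the leading coefficients: every other pair of terms lands strictly lower.
  module LeadingProduct (p q : Poly) (lp : LeadingTerm p) (lq : LeadingTerm q) where
    open LeadingTerm lp using () renaming (i to A₀; j to B₀)
    open LeadingTerm lq using () renaming (i to A₁; j to B₁)

    cp = coeffP p A₀ B₀
    cq = coeffP q A₁ B₁
    N = exponentBound p + exponentBound q

    innerSum : ℕ → ℕ → ℚ
    innerSum i j =
      ∑[ downFrom N ] (λ i' → ∑[ downFrom N ] (λ j' → coeffP q i' j' * δ (A₀ + A₁) (B₀ + B₁) (i + i') (j + j')))

    crossTerm : ∀ i j → (i , j) ≤ₗₑₓ (A₀ , B₀) → ∀ i' j' →
      coeffP q i' j' * δ (A₀ + A₁) (B₀ + B₁) (i + i') (j + j') ≡ δ i' j' A₁ B₁ * (δ i j A₀ B₀ * cq)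
    crossTerm i j ij≤ i' j' with (i' , j') ≟² (A₁ , B₁)
    crossTerm i j ij≤ i' j' | yes refl with (i , j) ≟² (A₀ , B₀)
    ... | yes refl rewrite δ-diag (A₀ + A₁) (B₀ + B₁) | δ-diag A₀ B₀ | δ-diag A₁ B₁ =
          trans (ℚP.*-identityʳ cq) (sym (trans (ℚP.*-identityˡ (1ℚ * cq)) (ℚP.*-identityˡ cq)))
    ... | no ne rewrite δ-off i j A₀ B₀ (ne ∘ sym) | δ-diag A₁ B₁
                      | δ-off (A₀ + A₁) (B₀ + B₁) (i + A₁) (j + B₁)
                          (λ e → ne (proj₁ (≤ₗₑₓ-+-cancel ij≤ (≤ₗₑₓ-refl (A₁ , B₁)) e))) =
          trans (ℚP.*-zeroʳ cq) (sym (trans (cong (1ℚ *_) (ℚP.*-zeroˡ cq)) (ℚP.*-zeroʳ 1ℚ)))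
    crossTerm i j ij≤ i' j' | no ne rewrite δ-off i' j' A₁ B₁ (ne ∘ sym) with coeffP q i' j' ℚP.≟ 0ℚ
    ... | yes z rewrite z = trans (ℚP.*-zeroˡ (δ (A₀ + A₁) (B₀ + B₁) (i + i') (j + j')))
                                  (sym (ℚP.*-zeroˡ (δ i j A₀ B₀ * cq)))
    ... | no nz rewrite δ-off (A₀ + A₁) (B₀ + B₁) (i + i') (j + j')
                          (λ e → ne (proj₂ (≤ₗₑₓ-+-cancel ij≤ (LeadingTerm.maximal lq i' j' nz) e))) =
          trans (ℚP.*-zeroʳ (coeffP q i' j')) (sym (ℚP.*-zeroˡ (δ i j A₀ B₀ * cq)))

    innerSum-value : ∀ i j → (i , j) ≤ₗₑₓ (A₀ , B₀) → innerSum i j ≡ δ i j A₀ B₀ * cq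
    innerSum-value i j ij≤ =
      trans (∑-cong (downFrom N) (λ i' → ∑-cong (downFrom N) (λ j' → crossTerm i j ij≤ i' j')))
            (∑∑-downFrom-δ N A₁ B₁ (λ _ _ → δ i j A₀ B₀ * cq) A₁<N B₁<N)
      where
      A₁<N = proj₁ (∈exponents⇒below q N (exponentsBelow-+ʳ p q) (LeadingTerm.∈exponents lq))
      B₁<N = proj₂ (∈exponents⇒below q N (exponentsBelow-+ʳ p q) (LeadingTerm.∈exponents lq))

    outerTerm : ∀ i j → coeffP p i j * innerSum i j ≡ δ i j A₀ B₀ * (cp * cq)
    outerTerm i j with coeffP p i j ℚP.≟ 0ℚ | (i , j) ≟² (A₀ , B₀)
    ... | yes z | yes refl = ⊥-elim (LeadingTerm.nonzero lp z)
    ... | yes z | no ne rewrite z | δ-off i j A₀ B₀ (ne ∘ sym) =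
          trans (ℚP.*-zeroˡ (innerSum i j)) (sym (ℚP.*-zeroˡ (cp * cq)))
    ... | no nz | yes refl rewrite innerSum-value A₀ B₀ (≤ₗₑₓ-refl (A₀ , B₀)) | δ-diag A₀ B₀ =
          trans (cong (cp *_) (ℚP.*-identityˡ cq)) (sym (ℚP.*-identityˡ (cp * cq)))
    ... | no nz | no ne rewrite innerSum-value i j (LeadingTerm.maximal lp i j nz) | δ-off i j A₀ B₀ (ne ∘ sym) =
          trans (cong (coeffP p i j *_) (ℚP.*-zeroˡ cq)) (trans (ℚP.*-zeroʳ (coeffP p i j)) (sym (ℚP.*-zeroˡ (cp * cq))))

    coeffP-*P-leading : coeffP (p *P q) (A₀ + A₁) (B₀ + B₁) ≡ cp * cq
    coeffP-*P-leading = begin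
      coeffP (p *P q) I J
        ≡⟨ coeffP≡pairing-δ (p *P q) I J ⟩
      pairing (p *P q) (δ I J)
        ≡⟨ pairing-*P p q (δ I J) ⟩
      pairing p (λ i j → pairing q (λ i' j' → δ I J (i + i') (j + j')))
        ≡⟨ pairing-cong p (λ i j → pairing≡∑coeffP q N _ (exponentsBelow-+ʳ p q)) ⟩
      pairing p innerSum
        ≡⟨ pairing≡∑coeffP p N innerSum (exponentsBelow-+ˡ p q) ⟩
      ∑[ downFrom N ] (λ i → ∑[ downFrom N ] (λ j → coeffP p i j * innerSum i j))
        ≡⟨ ∑-cong (downFrom N) (λ i → ∑-cong (downFrom N) (λ j → outerTerm i j)) ⟩
      ∑[ downFrom N ] (λ i → ∑[ downFrom N ] (λ j → δ i j A₀ B₀ * (cp * cq)))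
        ≡⟨ ∑∑-downFrom-δ N A₀ B₀ (λ _ _ → cp * cq) A₀<N B₀<N ⟩
      cp * cq ∎
      where
      open ≡-Reasoning
      I = A₀ + A₁
      J = B₀ + B₁
      A₀<N = proj₁ (∈exponents⇒below p N (exponentsBelow-+ˡ p q) (LeadingTerm.∈exponents lp))
      B₀<N = proj₂ (∈exponents⇒below p N (exponentsBelow-+ˡ p q) (LeadingTerm.∈exponents lp))

  *P-nonzero : ∀ p q → ¬ (p ≈P 0P) → ¬ (q ≈P 0P) → ¬ ((p *P q) ≈P 0P)
  *P-nonzero p q p≉0 q≉0 pq≈0 =
    ℚ-noZeroDivisors _ _ (LeadingTerm.nonzero lp) (LeadingTerm.nonzero lq)
      (trans (sym coeffP-*P-leading) (pq≈0 _ _))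
    where
    lp = leadingTerm p p≉0
    lq = leadingTerm q q≉0
    open LeadingProduct p q lp lq using (coeffP-*P-leading)

open IntegralDomain using (*P-nonzero)

module RationalFunctions where

  constP : ℚ → Poly
  constP c = (c , 0 , 0) ∷ []

  constP-homomorphism : ℚP.+-*-rawRing -Raw-AlmostCommutative⟶ fromCommutativeRing polynomialRing
  constP-homomorphism = record
    { ⟦_⟧ = constP
    ; +-homo = λ c c' → pairing≡⇒≈P (constP (c ℚ.+ c')) (constP c +P constP c') λ g →
        let open +-*-Solver in
        solve 3 (λ c c' x → (c :+ c') :* x :+ con 0ℚ := c :* x :+ (c' :* x :+ con 0ℚ)) refl c c' (g 0 0)
    ; *-homo = λ c c' i j → refl
    ; -‿homo = λ c i j → refl
    ; 0-homo = pairing≡⇒≈P (constP 0ℚ) 0P λ g → trans (ℚP.+-identityʳ _) (ℚP.*-zeroˡ (g 0 0))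
    ; 1-homo = λ i j → refl }

  constP-≟ : ∀ (x y : ℚ) → Maybe (constP x ≈P constP y)
  constP-≟ x y with x ℚP.≟ y
  ... | yes refl = just (λ i j → refl)
  ... | no _ = nothing

  open RingSolver ℚP.+-*-rawRing (fromCommutativeRing polynomialRing) constP-homomorphism constP-≟
    using (solve; _:=_; _:+_; _:*_; :-_; con)
  open import Relation.Binary.Reasoning.Setoid (CommutativeRing.setoid polynomialRing)

  constP-0 : constP 0ℚ ≈P 0P
  constP-0 = _-Raw-AlmostCommutative⟶_.0-homo constP-homomorphism

  ≈P0-stable : ∀ p → ¬ ¬ (p ≈P 0P) → p ≈P 0P
  ≈P0-stable p ¬¬p≈0 i j with coeffP p i j ℚP.≟ 0ℚ
  ... | yes z = z
  ... | no nz = ⊥-elim (¬¬p≈0 (λ e → nz (e i j)))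

  *P-cancelˡ : ∀ d x y → ¬ (d ≈P 0P) → (d *P x) ≈P (d *P y) → x ≈P y
  *P-cancelˡ d x y d≉0 e = begin
      x                    ≈⟨ solve 2 (λ x y → x := (x :+ (:- y)) :+ y) (λ i j → refl) x y ⟩
      (x +P negP y) +P y   ≈⟨ +P-cong {x +P negP y} {0P} {y} {y} x-y≈0 (λ i j → refl) ⟩
      0P +P y              ≈⟨ (λ i j → refl) ⟩
      y                    ∎
    where
    d[x-y]≈0 : (d *P (x +P negP y)) ≈P 0P
    d[x-y]≈0 = begin
      d *P (x +P negP y)          ≈⟨ solve 3 (λ d x y → d :* (x :+ (:- y)) := d :* x :+ (:- (d :* y))) (λ i j → refl) d x y ⟩
      (d *P x) +P negP (d *P y)   ≈⟨ +P-cong {d *P x} {d *P y} {negP (d *P y)} {negP (d *P y)} e (λ i j → refl) ⟩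
      (d *P y) +P negP (d *P y)   ≈⟨ negP-inverseʳ (d *P y) ⟩
      0P                          ∎
    x-y≈0 : (x +P negP y) ≈P 0P
    x-y≈0 = ≈P0-stable (x +P negP y) (λ x-y≉0 → *P-nonzero d (x +P negP y) d≉0 x-y≉0 d[x-y]≈0)

  ≈Q-refl : ∀ x → x ≈Q x
  ≈Q-refl (n , d) i j = refl

  ≡⇒≈Q : ∀ x y → x ≡ y → x ≈Q y
  ≡⇒≈Q x y refl = ≈Q-refl x

  ≈Q-sym : ∀ x y → x ≈Q y → y ≈Q x
  ≈Q-sym (n , d) (n' , d') e i j = sym (e i j)

  -- Transitivity needs the middle denominator to be nonzero, to cancel it.
  ≈Q-trans : ∀ x y z → ValidQ y → x ≈Q y → y ≈Q z → x ≈Q z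
  ≈Q-trans (n₁ , d₁) (n₂ , d₂) (n₃ , d₃) d₂≉0 e₁ e₂ = *P-cancelˡ d₂ (n₁ *P d₃) (n₃ *P d₁) d₂≉0 (begin
    d₂ *P (n₁ *P d₃)   ≈⟨ solve 3 (λ d₂ n₁ d₃ → d₂ :* (n₁ :* d₃) := (n₁ :* d₂) :* d₃) (λ i j → refl) d₂ n₁ d₃ ⟩
    (n₁ *P d₂) *P d₃   ≈⟨ *P-cong {n₁ *P d₂} {n₂ *P d₁} {d₃} {d₃} e₁ (λ i j → refl) ⟩
    (n₂ *P d₁) *P d₃   ≈⟨ solve 3 (λ n₂ d₁ d₃ → (n₂ :* d₁) :* d₃ := d₁ :* (n₂ :* d₃)) (λ i j → refl) n₂ d₁ d₃ ⟩
    d₁ *P (n₂ *P d₃)   ≈⟨ *P-cong {d₁} {d₁} {n₂ *P d₃} {n₃ *P d₂} (λ i j → refl) e₂ ⟩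
    d₁ *P (n₃ *P d₂)   ≈⟨ solve 3 (λ d₁ n₃ d₂ → d₁ :* (n₃ :* d₂) := d₂ :* (n₃ :* d₁)) (λ i j → refl) d₁ n₃ d₂ ⟩
    d₂ *P (n₃ *P d₁)   ∎)

  valid-1Q : ValidQ 1Q
  valid-1Q 1≈0 with 1≈0 0 0
  ... | ()

  valid-0Q : ValidQ 0Q
  valid-0Q = valid-1Q

  valid-*Q : ∀ x y → ValidQ x → ValidQ y → ValidQ (x *Q y)
  valid-*Q (n , d) (n' , d') = *P-nonzero d d'

  valid-+Q : ∀ x y → ValidQ x → ValidQ y → ValidQ (x +Q y)
  valid-+Q (n , d) (n' , d') = *P-nonzero d d'

  negQ : QQ → QQ
  negQ (n , d) = (negP n , d)

  valid-negQ : ∀ x → ValidQ x → ValidQ (negQ x)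
  valid-negQ (n , d) d≉0 = d≉0

  +Q-cong : ∀ x x' y y' → x ≈Q x' → y ≈Q y' → (x +Q y) ≈Q (x' +Q y')
  +Q-cong (n₁ , d₁) (n₁' , d₁') (n₂ , d₂) (n₂' , d₂') e₁ e₂ = begin
    ((n₁ *P d₂) +P (n₂ *P d₁)) *P (d₁' *P d₂')
      ≈⟨ solve 6 (λ n₁ d₁ n₂ d₂ d₁' d₂' → ((n₁ :* d₂) :+ (n₂ :* d₁)) :* (d₁' :* d₂')
                    := (n₁ :* d₁') :* (d₂ :* d₂') :+ (n₂ :* d₂') :* (d₁ :* d₁'))
                 (λ i j → refl) n₁ d₁ n₂ d₂ d₁' d₂' ⟩
    ((n₁ *P d₁') *P (d₂ *P d₂')) +P ((n₂ *P d₂') *P (d₁ *P d₁'))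
      ≈⟨ +P-cong {(n₁ *P d₁') *P (d₂ *P d₂')} {(n₁' *P d₁) *P (d₂ *P d₂')}
                 {(n₂ *P d₂') *P (d₁ *P d₁')} {(n₂' *P d₂) *P (d₁ *P d₁')}
           (*P-cong {n₁ *P d₁'} {n₁' *P d₁} {d₂ *P d₂'} {d₂ *P d₂'} e₁ (λ i j → refl))
           (*P-cong {n₂ *P d₂'} {n₂' *P d₂} {d₁ *P d₁'} {d₁ *P d₁'} e₂ (λ i j → refl)) ⟩
    ((n₁' *P d₁) *P (d₂ *P d₂')) +P ((n₂' *P d₂) *P (d₁ *P d₁'))
      ≈⟨ solve 6 (λ n₁' d₁ n₂' d₂ d₁' d₂' → (n₁' :* d₁) :* (d₂ :* d₂') :+ (n₂' :* d₂) :* (d₁ :* d₁')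
                    := ((n₁' :* d₂') :+ (n₂' :* d₁')) :* (d₁ :* d₂))
                 (λ i j → refl) n₁' d₁ n₂' d₂ d₁' d₂' ⟩
    ((n₁' *P d₂') +P (n₂' *P d₁')) *P (d₁ *P d₂) ∎

  +Q-comm : ∀ x y → (x +Q y) ≈Q (y +Q x)
  +Q-comm (n₁ , d₁) (n₂ , d₂) =
    solve 4 (λ n₁ d₁ n₂ d₂ → ((n₁ :* d₂) :+ (n₂ :* d₁)) :* (d₂ :* d₁) := ((n₂ :* d₁) :+ (n₁ :* d₂)) :* (d₁ :* d₂))
      (λ i j → refl) n₁ d₁ n₂ d₂

  +Q-assoc : ∀ x y z → ((x +Q y) +Q z) ≈Q (x +Q (y +Q z))
  +Q-assoc (n₁ , d₁) (n₂ , d₂) (n₃ , d₃) = solve 6 (λ n₁ d₁ n₂ d₂ n₃ d₃ →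
    ((((n₁ :* d₂) :+ (n₂ :* d₁)) :* d₃) :+ (n₃ :* (d₁ :* d₂))) :* (d₁ :* (d₂ :* d₃))
    := ((n₁ :* (d₂ :* d₃)) :+ (((n₂ :* d₃) :+ (n₃ :* d₂)) :* d₁)) :* ((d₁ :* d₂) :* d₃))
    (λ i j → refl) n₁ d₁ n₂ d₂ n₃ d₃

  +Q-identityˡ : ∀ x → (0Q +Q x) ≈Q x
  +Q-identityˡ (n , d) = solve 2 (λ n d → (n :* con 1ℚ) :* d := n :* (con 1ℚ :* d)) (λ i j → refl) n d

  +Q-identityʳ : ∀ x → (x +Q 0Q) ≈Q x
  +Q-identityʳ (n , d) = begin
    ((n *P 1P) +P 0P) *P d
      ≈⟨ *P-cong {(n *P 1P) +P 0P} {(n *P 1P) +P constP 0ℚ} {d} {d}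
           (+P-cong {n *P 1P} {n *P 1P} {0P} {constP 0ℚ} (λ i j → refl)
              (λ i j → sym (constP-0 i j)))
           (λ i j → refl) ⟩
    ((n *P 1P) +P constP 0ℚ) *P d
      ≈⟨ solve 2 (λ n d → ((n :* con 1ℚ) :+ con 0ℚ) :* d := n :* (d :* con 1ℚ)) (λ i j → refl) n d ⟩
    n *P (d *P 1P) ∎

  *Q-identityʳ : ∀ x → (x *Q 1Q) ≈Q x
  *Q-identityʳ (n , d) = solve 2 (λ n d → (n :* con 1ℚ) :* d := n :* (d :* con 1ℚ)) (λ i j → refl) n d

  *Q-zeroʳ : ∀ x → (x *Q 0Q) ≈Q 0Q
  *Q-zeroʳ (n , d) = *P-cong {n *P 0P} {0P} {1P} {1P} (CommutativeRing.zeroʳ polynomialRing n) (λ i j → refl)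

  ≈0Q⇒*Q≈0Q : ∀ x y → x ≈Q 0Q → (x *Q y) ≈Q 0Q
  ≈0Q⇒*Q≈0Q (n , d) (n' , d') n≈0 = begin
    (n *P n') *P 1P   ≈⟨ solve 2 (λ n n' → (n :* n') :* con 1ℚ := (n :* con 1ℚ) :* n') (λ i j → refl) n n' ⟩
    (n *P 1P) *P n'   ≈⟨ *P-cong {n *P 1P} {0P} {n'} {n'} n≈0 (λ i j → refl) ⟩
    0P *P n'          ∎

  +Q-inverseʳ : ∀ x → (x +Q negQ x) ≈Q 0Q
  +Q-inverseʳ (n , d) = begin
    ((n *P d) +P (negP n *P d)) *P 1P ≈⟨ solve 2 (λ n d → ((n :* d) :+ ((:- n) :* d)) :* con 1ℚ := con 0ℚ) (λ i j → refl) n d ⟩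
    constP 0ℚ                         ≈⟨ constP-0 ⟩
    0P                                ∎

  +Q-negQ-cancelˡ : ∀ x y → ValidQ x → ValidQ y → (x +Q (y +Q negQ x)) ≈Q y
  +Q-negQ-cancelˡ x y x≉ y≉ =
    ≈Q-trans (x +Q (y +Q negQ x)) (x +Q (negQ x +Q y)) y
      (valid-+Q x (negQ x +Q y) x≉ (valid-+Q (negQ x) y (valid-negQ x x≉) y≉))
      (+Q-cong x x (y +Q negQ x) (negQ x +Q y) (≈Q-refl x) (+Q-comm y (negQ x)))
    (≈Q-trans (x +Q (negQ x +Q y)) ((x +Q negQ x) +Q y) y
      (valid-+Q (x +Q negQ x) y (valid-+Q x (negQ x) x≉ (valid-negQ x x≉)) y≉)
      (≈Q-sym ((x +Q negQ x) +Q y) (x +Q (negQ x +Q y)) (+Q-assoc x (negQ x) y))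
    (≈Q-trans ((x +Q negQ x) +Q y) (0Q +Q y) y (valid-+Q 0Q y valid-0Q y≉)
      (+Q-cong (x +Q negQ x) 0Q y y (+Q-inverseʳ x) (≈Q-refl y))
      (+Q-identityˡ y)))

  +Q-≈0Q : ∀ x z → ValidQ x → z ≈Q 0Q → (x +Q z) ≈Q x
  +Q-≈0Q x z x≉ z≈0 =
    ≈Q-trans (x +Q z) (x +Q 0Q) x (valid-+Q x 0Q x≉ valid-0Q) (+Q-cong x x z 0Q (≈Q-refl x) z≈0) (+Q-identityʳ x)

  valid-sumQ : ∀ xs → All ValidQ xs → ValidQ (sumQ xs)
  valid-sumQ [] _ = valid-0Q
  valid-sumQ (x ∷ xs) (v ∷ vs) = valid-+Q x (sumQ xs) v (valid-sumQ xs vs)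

  valid-sumQ-map : ∀ {A : Set} (F : A → QQ) xs → (∀ y → y ∈ xs → ValidQ (F y)) → ValidQ (sumQ (map F xs))
  valid-sumQ-map F xs v = valid-sumQ (map F xs) (AllP.map⁺ (All.tabulate (λ {y} → v y)))

  sumQ-map-≈0Q : ∀ {A : Set} (F : A → QQ) xs → (∀ y → y ∈ xs → F y ≈Q 0Q) → sumQ (map F xs) ≈Q 0Q
  sumQ-map-≈0Q F [] h = ≈Q-refl 0Q
  sumQ-map-≈0Q F (y ∷ xs) h =
    +Q-cong (F y) 0Q (sumQ (map F xs)) 0Q (h y (here refl)) (sumQ-map-≈0Q F xs (λ z z∈ → h z (there z∈)))

  sumQ-map-single : ∀ {A I : Set} (F : A → QQ) (idx : A → I) xs x → x ∈ xs →
    AllPairs (λ u v → ¬ u ≡ v) (map idx xs) →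
    (∀ y → y ∈ xs → ValidQ (F y)) →
    (∀ y → y ∈ xs → ¬ idx y ≡ idx x → F y ≈Q 0Q) →
    sumQ (map F xs) ≈Q F x
  sumQ-map-single F idx (y ∷ xs) .y (here refl) (distinct ∷ _) V Z =
    ≈Q-trans (F y +Q sumQ (map F xs)) (F y +Q 0Q) (F y) (valid-+Q (F y) 0Q (V y (here refl)) valid-0Q)
      (+Q-cong (F y) (F y) (sumQ (map F xs)) 0Q (≈Q-refl (F y))
        (sumQ-map-≈0Q F xs (λ z z∈ → Z z (there z∈) (λ e → All.lookup distinct (MP.∈-map⁺ idx z∈) (sym e)))))
      (+Q-identityʳ (F y))
  sumQ-map-single F idx (y ∷ xs) x (there x∈) (distinct ∷ rest) V Z =
    ≈Q-trans (F y +Q sumQ (map F xs)) (0Q +Q F x) (F x) (valid-+Q 0Q (F x) valid-0Q (V x (there x∈)))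
      (+Q-cong (F y) 0Q (sumQ (map F xs)) (F x) (Z y (here refl) (λ e → All.lookup distinct (MP.∈-map⁺ idx x∈) e))
         (sumQ-map-single F idx xs x x∈ rest (λ z z∈ → V z (there z∈)) (λ z z∈ → Z z (there z∈))))
      (+Q-identityˡ (F x))

  sumQ-++ : ∀ xs ys → All ValidQ xs → All ValidQ ys → sumQ (xs ++ ys) ≈Q (sumQ xs +Q sumQ ys)
  sumQ-++ [] ys _ vys = ≈Q-sym (0Q +Q sumQ ys) (sumQ ys) (+Q-identityˡ (sumQ ys))
  sumQ-++ (x ∷ xs) ys (vx ∷ vxs) vys =
    ≈Q-trans (x +Q sumQ (xs ++ ys)) (x +Q (sumQ xs +Q sumQ ys)) ((x +Q sumQ xs) +Q sumQ ys)
      (valid-+Q x (sumQ xs +Q sumQ ys) vx (valid-+Q (sumQ xs) (sumQ ys) (valid-sumQ xs vxs) (valid-sumQ ys vys)))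
      (+Q-cong x x (sumQ (xs ++ ys)) (sumQ xs +Q sumQ ys) (≈Q-refl x) (sumQ-++ xs ys vxs vys))
      (≈Q-sym ((x +Q sumQ xs) +Q sumQ ys) (x +Q (sumQ xs +Q sumQ ys)) (+Q-assoc x (sumQ xs) (sumQ ys)))

open RationalFunctions

indicator : Bool → QQ
indicator b = if b then 1Q else 0Q

valid-indicator : ∀ b → ValidQ (indicator b)
valid-indicator true = valid-1Q
valid-indicator false = valid-0Q

indicator-∧ : ∀ b c → (indicator b *Q indicator c) ≡ indicator (b ∧ c)
indicator-∧ true true = refl
indicator-∧ true false = refl
indicator-∧ false true = refl
indicator-∧ false false = refl

_==ᴹ_ : Mono → Mono → Bool
x ==ᴹ y = does (LP.≡-dec ℕ._≟_ x y)

==ᴹ⇒≡ : ∀ x y → (x ==ᴹ y) ≡ true → x ≡ y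
==ᴹ⇒≡ x y e with LP.≡-dec ℕ._≟_ x y
... | yes p = p

==ᴹ-refl : ∀ x → (x ==ᴹ x) ≡ true
==ᴹ-refl x with LP.≡-dec ℕ._≟_ x x
... | yes _ = refl
... | no x≢x = ⊥-elim (x≢x refl)

-- Divisibility of monomials of the same length: x^t ∣ x^e.
_≤ᴹ_ : Mono → Mono → Bool
[] ≤ᴹ [] = true
(a ∷ t) ≤ᴹ (b ∷ e) = (a <ᵇ suc b) ∧ (t ≤ᴹ e)
[] ≤ᴹ (_ ∷ _) = false
(_ ∷ _) ≤ᴹ [] = false

countTrue : List Bool → ℕ
countTrue [] = 0
countTrue (true ∷ bs) = suc (countTrue bs)
countTrue (false ∷ bs) = countTrue bs

countTrue≡0⇒or≡false : ∀ bs → countTrue bs ≡ 0 → or bs ≡ false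
countTrue≡0⇒or≡false [] _ = refl
countTrue≡0⇒or≡false (false ∷ bs) e = countTrue≡0⇒or≡false bs e

sumQ-indicators : ∀ bs → countTrue bs ≤ 1 → sumQ (map indicator bs) ≡ indicator (or bs)
sumQ-indicators [] _ = refl
sumQ-indicators (true ∷ bs) (s≤s le)
  rewrite sumQ-indicators bs (ℕP.≤-trans le z≤n) | countTrue≡0⇒or≡false bs (ℕP.n≤0⇒n≡0 le) = refl
sumQ-indicators (false ∷ bs) c with or bs | sumQ-indicators bs c
... | true | e rewrite e = refl
... | false | e rewrite e = refl

or-map-==ᴹ-∧ : ∀ (t : Mono) (G : Mono → Bool) xs →
  or (map (λ x → (x ==ᴹ t) ∧ G x) xs) ≡ or (map (_==ᴹ t) xs) ∧ G t
or-map-==ᴹ-∧ t G [] = refl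
or-map-==ᴹ-∧ t G (x ∷ xs) with LP.≡-dec ℕ._≟_ x t
... | yes refl with G x in eq
...   | true = refl
...   | false = trans (or-map-==ᴹ-∧ t G xs) (trans (cong (or (map (_==ᴹ t) xs) ∧_) eq) (BoolP.∧-zeroʳ _))
or-map-==ᴹ-∧ t G (x ∷ xs) | no _ = or-map-==ᴹ-∧ t G xs

countTrue-map-==ᴹ-∧ : ∀ (t : Mono) (G : Mono → Bool) xs →
  countTrue (map (λ x → (x ==ᴹ t) ∧ G x) xs) ≤ countTrue (map (_==ᴹ t) xs)
countTrue-map-==ᴹ-∧ t G [] = z≤n
countTrue-map-==ᴹ-∧ t G (x ∷ xs) with LP.≡-dec ℕ._≟_ x t
... | yes refl with G x
...   | true = s≤s (countTrue-map-==ᴹ-∧ t G xs)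
...   | false = ℕP.≤-trans (countTrue-map-==ᴹ-∧ t G xs) (ℕP.n≤1+n _)
countTrue-map-==ᴹ-∧ t G (x ∷ xs) | no _ = countTrue-map-==ᴹ-∧ t G xs

or-++ : ∀ xs ys → or (xs ++ ys) ≡ or xs ∨ or ys
or-++ [] ys = refl
or-++ (true ∷ xs) ys = refl
or-++ (false ∷ xs) ys = or-++ xs ys

countTrue-++ : ∀ xs ys → countTrue (xs ++ ys) ≡ countTrue xs + countTrue ys
countTrue-++ [] ys = refl
countTrue-++ (true ∷ xs) ys = cong suc (countTrue-++ xs ys)
countTrue-++ (false ∷ xs) ys = countTrue-++ xs ys

module BelowEnumeration where

  -- below (n ∷ e) = prefixedBy (suc n) (below e)
  prefixedBy : ℕ → List Mono → List Mono
  prefixedBy N B = concatMap (λ k → map (k ∷_) B) (upTo N)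

  prefixedBy-suc : ∀ N B → prefixedBy (suc N) B ≡ prefixedBy N B ++ map (N ∷_) B
  prefixedBy-suc N B = begin
    concatMap f (upTo (suc N))          ≡⟨ cong (concatMap f) (sym (LP.upTo-∷ʳ N)) ⟩
    concatMap f (upTo N ++ [ N ])       ≡⟨ LP.concatMap-++ f (upTo N) [ N ] ⟩
    concatMap f (upTo N) ++ (f N ++ []) ≡⟨ cong (concatMap f (upTo N) ++_) (LP.++-identityʳ (f N)) ⟩
    prefixedBy N B ++ map (N ∷_) B      ∎
    where open ≡-Reasoning
          f = λ k → map (k ∷_) B

  or-map-cons : ∀ N t₀ t B → or (map (_==ᴹ (t₀ ∷ t)) (map (N ∷_) B)) ≡ (N ≡ᵇ t₀) ∧ or (map (_==ᴹ t) B)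
  or-map-cons N t₀ t [] with N ≡ᵇ t₀
  ... | true = refl
  ... | false = refl
  or-map-cons N t₀ t (x ∷ B) rewrite or-map-cons N t₀ t B with N ≡ᵇ t₀
  ... | true = refl
  ... | false = refl

  countTrue-map-cons : ∀ N t₀ t B →
    countTrue (map (_==ᴹ (t₀ ∷ t)) (map (N ∷_) B)) ≡ (if N ≡ᵇ t₀ then countTrue (map (_==ᴹ t) B) else 0)
  countTrue-map-cons N t₀ t [] with N ≡ᵇ t₀
  ... | true = refl
  ... | false = refl
  countTrue-map-cons N t₀ t (x ∷ B) with N ≡ᵇ t₀ | countTrue-map-cons N t₀ t B
  ... | true | ih with x ==ᴹ t
  ...   | true = cong suc ih
  ...   | false = ih
  countTrue-map-cons N t₀ t (x ∷ B) | false | ih = ih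

  or-map-cons-[] : ∀ N B → or (map (_==ᴹ []) (map (N ∷_) B)) ≡ false
  or-map-cons-[] N [] = refl
  or-map-cons-[] N (x ∷ B) = or-map-cons-[] N B

  countTrue-map-cons-[] : ∀ N B → countTrue (map (_==ᴹ []) (map (N ∷_) B)) ≡ 0
  countTrue-map-cons-[] N [] = refl
  countTrue-map-cons-[] N (x ∷ B) = countTrue-map-cons-[] N B

  <ᵇ-suc : ∀ t N → (t <ᵇ suc N) ≡ (t <ᵇ N) ∨ (N ≡ᵇ t)
  <ᵇ-suc zero zero = refl
  <ᵇ-suc zero (suc N) = refl
  <ᵇ-suc (suc t) zero = refl
  <ᵇ-suc (suc t) (suc N) = <ᵇ-suc t N

  <ᵇ⇒≢ᵇ : ∀ t N → (t <ᵇ N) ≡ true → (N ≡ᵇ t) ≡ false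
  <ᵇ⇒≢ᵇ zero (suc N) _ = refl
  <ᵇ⇒≢ᵇ (suc t) (suc N) e = <ᵇ⇒≢ᵇ t N e

  or-prefixedBy : ∀ N t₀ t B → or (map (_==ᴹ (t₀ ∷ t)) (prefixedBy N B)) ≡ (t₀ <ᵇ N) ∧ or (map (_==ᴹ t) B)
  or-prefixedBy zero t₀ t B = refl
  or-prefixedBy (suc N) t₀ t B
    rewrite prefixedBy-suc N B | LP.map-++ (_==ᴹ (t₀ ∷ t)) (prefixedBy N B) (map (N ∷_) B)
          | or-++ (map (_==ᴹ (t₀ ∷ t)) (prefixedBy N B)) (map (_==ᴹ (t₀ ∷ t)) (map (N ∷_) B))
          | or-prefixedBy N t₀ t B | or-map-cons N t₀ t B | <ᵇ-suc t₀ N =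
    sym (BoolP.∧-distribʳ-∨ (or (map (_==ᴹ t) B)) (t₀ <ᵇ N) (N ≡ᵇ t₀))

  countTrue-prefixedBy : ∀ N t₀ t B →
    countTrue (map (_==ᴹ (t₀ ∷ t)) (prefixedBy N B)) ≡ (if t₀ <ᵇ N then countTrue (map (_==ᴹ t) B) else 0)
  countTrue-prefixedBy zero t₀ t B = refl
  countTrue-prefixedBy (suc N) t₀ t B
    rewrite prefixedBy-suc N B | LP.map-++ (_==ᴹ (t₀ ∷ t)) (prefixedBy N B) (map (N ∷_) B)
          | countTrue-++ (map (_==ᴹ (t₀ ∷ t)) (prefixedBy N B)) (map (_==ᴹ (t₀ ∷ t)) (map (N ∷_) B))
          | countTrue-prefixedBy N t₀ t B | countTrue-map-cons N t₀ t B | <ᵇ-suc t₀ N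
    with t₀ <ᵇ N in eq
  ... | true rewrite <ᵇ⇒≢ᵇ t₀ N eq = ℕP.+-identityʳ _
  ... | false with N ≡ᵇ t₀
  ...   | true = refl
  ...   | false = refl

  or-prefixedBy-[] : ∀ N B → or (map (_==ᴹ []) (prefixedBy N B)) ≡ false
  or-prefixedBy-[] zero B = refl
  or-prefixedBy-[] (suc N) B
    rewrite prefixedBy-suc N B | LP.map-++ (_==ᴹ []) (prefixedBy N B) (map (N ∷_) B)
          | or-++ (map (_==ᴹ []) (prefixedBy N B)) (map (_==ᴹ []) (map (N ∷_) B))
          | or-prefixedBy-[] N B | or-map-cons-[] N B = refl

  countTrue-prefixedBy-[] : ∀ N B → countTrue (map (_==ᴹ []) (prefixedBy N B)) ≡ 0
  countTrue-prefixedBy-[] zero B = refl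
  countTrue-prefixedBy-[] (suc N) B
    rewrite prefixedBy-suc N B | LP.map-++ (_==ᴹ []) (prefixedBy N B) (map (N ∷_) B)
          | countTrue-++ (map (_==ᴹ []) (prefixedBy N B)) (map (_==ᴹ []) (map (N ∷_) B))
          | countTrue-prefixedBy-[] N B | countTrue-map-cons-[] N B = refl

  or-below : ∀ e t → or (map (_==ᴹ t) (below e)) ≡ t ≤ᴹ e
  or-below [] [] = refl
  or-below [] (_ ∷ _) = refl
  or-below (n ∷ e) [] = or-prefixedBy-[] (suc n) (below e)
  or-below (n ∷ e) (t₀ ∷ t) rewrite or-prefixedBy (suc n) t₀ t (below e) | or-below e t = refl

  countTrue-below : ∀ e t → countTrue (map (_==ᴹ t) (below e)) ≤ 1
  countTrue-below [] [] = s≤s z≤n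
  countTrue-below [] (_ ∷ _) = z≤n
  countTrue-below (n ∷ e) [] rewrite countTrue-prefixedBy-[] (suc n) (below e) = z≤n
  countTrue-below (n ∷ e) (t₀ ∷ t) rewrite countTrue-prefixedBy (suc n) t₀ t (below e) with t₀ <ᵇ suc n
  ... | true = countTrue-below e t
  ... | false = z≤n

  all-concatMap : ∀ {P : Mono → Set} (f : ℕ → List Mono) xs → (∀ k → All P (f k)) → All P (concatMap f xs)
  all-concatMap f [] h = []
  all-concatMap f (k ∷ xs) h = AllP.++⁺ (h k) (all-concatMap f xs h)

  length-below : ∀ e → All (λ x → length x ≡ length e) (below e)
  length-below [] = refl ∷ []
  length-below (n ∷ e) = all-concatMap (λ k → map (k ∷_) (below e)) (upTo (suc n))
    (λ k → AllP.map⁺ (All.map (cong suc) (length-below e)))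

  below-∷ʳ-0 : ∀ e → below (e ++ [ 0 ]) ≡ map (_++ [ 0 ]) (below e)
  below-∷ʳ-0 [] = refl
  below-∷ʳ-0 (n ∷ e) = begin
    concatMap (λ k → map (k ∷_) (below (e ++ [ 0 ]))) U
      ≡⟨ LP.concatMap-cong (λ k → trans (cong (map (k ∷_)) (below-∷ʳ-0 e))
                                        (trans (sym (LP.map-∘ (below e))) (LP.map-∘ (below e)))) U ⟩
    concatMap (λ k → map (_++ [ 0 ]) (map (k ∷_) (below e))) U
      ≡⟨ LP.map-concatMap (_++ [ 0 ]) (λ k → map (k ∷_) (below e)) U ⟨
    map (_++ [ 0 ]) (below (n ∷ e)) ∎
    where open ≡-Reasoning
          U = upTo (suc n)

open BelowEnumeration using (or-below; countTrue-below; length-below; below-∷ʳ-0)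

replicate-0-∷ʳ : ∀ j → replicate j 0 ++ [ 0 ] ≡ 0 ∷ replicate j 0
replicate-0-∷ʳ zero = refl
replicate-0-∷ʳ (suc j) = cong (0 ∷_) (replicate-0-∷ʳ j)

reverse-replicate-0 : ∀ j → reverse (replicate j 0) ≡ replicate j 0
reverse-replicate-0 zero = refl
reverse-replicate-0 (suc j) = begin
  reverse (0 ∷ replicate j 0)      ≡⟨ LP.unfold-reverse 0 (replicate j 0) ⟩
  reverse (replicate j 0) ++ [ 0 ] ≡⟨ cong (_++ [ 0 ]) (reverse-replicate-0 j) ⟩
  replicate j 0 ++ [ 0 ]           ≡⟨ replicate-0-∷ʳ j ⟩
  0 ∷ replicate j 0                ∎
  where open ≡-Reasoning

dropWhile-0-split : ∀ r → ∃ λ j → r ≡ replicate j 0 ++ dropWhile (ℕ._≟ 0) r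
dropWhile-0-split [] = 0 , refl
dropWhile-0-split (zero ∷ r) with dropWhile-0-split r
... | j , e = suc j , cong (0 ∷_) e
dropWhile-0-split (suc x ∷ r) = 0 , refl

strip-split : ∀ x → ∃ λ j → x ≡ strip x ++ replicate j 0
strip-split x with dropWhile-0-split (reverse x)
... | j , e = j , (begin
  x                                       ≡⟨ LP.reverse-involutive x ⟨
  reverse (reverse x)                     ≡⟨ cong reverse e ⟩
  reverse (replicate j 0 ++ r)            ≡⟨ LP.reverse-++ (replicate j 0) r ⟩
  reverse r ++ reverse (replicate j 0)    ≡⟨ cong (reverse r ++_) (reverse-replicate-0 j) ⟩
  strip x ++ replicate j 0                ∎)
  where open ≡-Reasoning
        r = dropWhile (ℕ._≟ 0) (reverse x)

strip-∷ʳ-0 : ∀ e → strip (e ++ [ 0 ]) ≡ strip e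
strip-∷ʳ-0 e = cong (reverse ∘ dropWhile (ℕ._≟ 0)) (LP.reverse-++ e [ 0 ])

++-replicate-0-invariant : ∀ {B : Set} (F : Mono → B) → (∀ e → F (e ++ [ 0 ]) ≡ F e) →
  ∀ e j → F (e ++ replicate j 0) ≡ F e
++-replicate-0-invariant F F∷ʳ0 e zero = cong F (LP.++-identityʳ e)
++-replicate-0-invariant F F∷ʳ0 e (suc j) = begin
  F (e ++ 0 ∷ replicate j 0)       ≡⟨ cong F (LP.++-assoc e [ 0 ] (replicate j 0)) ⟨
  F ((e ++ [ 0 ]) ++ replicate j 0) ≡⟨ ++-replicate-0-invariant F F∷ʳ0 (e ++ [ 0 ]) j ⟩
  F (e ++ [ 0 ])                   ≡⟨ F∷ʳ0 e ⟩
  F e                              ∎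
  where open ≡-Reasoning

strip-injective : ∀ x y → length x ≡ length y → strip x ≡ strip y → x ≡ y
strip-injective x y |x|≡|y| sx≡sy with strip-split x | strip-split y
... | j , ex | k , ey = trans ex (trans (cong₂ (λ s n → s ++ replicate n 0) sx≡sy j≡k) (sym ey))
  where
  j≡k : j ≡ k
  j≡k = ℕP.+-cancelˡ-≡ (length (strip y)) j k (begin
    length (strip y) + j                         ≡⟨ cong (λ s → length s + j) sx≡sy ⟨
    length (strip x) + j                         ≡⟨ cong (length (strip x) +_) (LP.length-replicate j) ⟨
    length (strip x) + length (replicate j 0)    ≡⟨ LP.length-++ (strip x) ⟨
    length (strip x ++ replicate j 0)            ≡⟨ cong length ex ⟨
    length x                                     ≡⟨ |x|≡|y| ⟩
    length y                                     ≡⟨ cong length ey ⟩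
    length (strip y ++ replicate k 0)            ≡⟨ LP.length-++ (strip y) ⟩
    length (strip y) + length (replicate k 0)    ≡⟨ cong (length (strip y) +_) (LP.length-replicate k) ⟩
    length (strip y) + k                         ∎)
    where open ≡-Reasoning

==ᴹ-strip : ∀ x A j → length x ≡ length (A ++ replicate j 0) →
  (strip x ==ᴹ strip A) ≡ (x ==ᴹ (A ++ replicate j 0))
==ᴹ-strip x A j |x|≡ with LP.≡-dec ℕ._≟_ (strip x) (strip A) | LP.≡-dec ℕ._≟_ x (A ++ replicate j 0)
... | yes _ | yes _ = refl
... | no _ | no _ = refl
... | yes p | no q = ⊥-elim (q (strip-injective x (A ++ replicate j 0) |x|≡
                                  (trans p (sym (++-replicate-0-invariant strip strip-∷ʳ-0 A j)))))
... | no p | yes refl = ⊥-elim (p (++-replicate-0-invariant strip strip-∷ʳ-0 A j))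

zipWith-++ : ∀ (f : ℕ → ℕ → ℕ) e x a b → length x ≡ length e →
  zipWith f (e ++ a) (x ++ b) ≡ zipWith f e x ++ zipWith f a b
zipWith-++ f [] [] a b _ = refl
zipWith-++ f (y ∷ e) (z ∷ x) a b el = cong (f y z ∷_) (zipWith-++ f e x a b (ℕP.suc-injective el))

and-take-∷ʳ-0 : ∀ k y → and (map (_≡ᵇ 0) (take k (y ++ [ 0 ]))) ≡ and (map (_≡ᵇ 0) (take k y))
and-take-∷ʳ-0 zero y = refl
and-take-∷ʳ-0 (suc zero) [] = refl
and-take-∷ʳ-0 (suc (suc k)) [] = refl
and-take-∷ʳ-0 (suc k) (x ∷ y) = cong ((x ≡ᵇ 0) ∧_) (and-take-∷ʳ-0 k y)

positives : List ℕ → List ℕ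
positives = filterᵇ (λ n → 1 ≤ᵇ n)

positives-∷ʳ-0 : ∀ y → positives (y ++ [ 0 ]) ≡ positives y
positives-∷ʳ-0 [] = refl
positives-∷ʳ-0 (zero ∷ y) = positives-∷ʳ-0 y
positives-∷ʳ-0 (suc x ∷ y) = cong (suc x ∷_) (positives-∷ʳ-0 y)

positives-drop-∷ʳ-0 : ∀ k y → positives (drop k (y ++ [ 0 ])) ≡ positives (drop k y)
positives-drop-∷ʳ-0 zero y = positives-∷ʳ-0 y
positives-drop-∷ʳ-0 (suc zero) [] = refl
positives-drop-∷ʳ-0 (suc (suc k)) [] = refl
positives-drop-∷ʳ-0 (suc k) (x ∷ y) = positives-drop-∷ʳ-0 k y

monomialSym-∷ʳ-0 : ∀ k λ′ y → monomialSym k λ′ (y ++ [ 0 ]) ≡ monomialSym k λ′ y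
monomialSym-∷ʳ-0 k λ′ y rewrite and-take-∷ʳ-0 k y | positives-drop-∷ʳ-0 k y = refl

basisElem-∷ʳ-0 : ∀ m ℓ a λ′ e → basisElem m ℓ a λ′ (e ++ [ 0 ]) ≡ basisElem m ℓ a λ′ e
basisElem-∷ʳ-0 m ℓ a λ′ e = cong sumQ (begin
  map F (below (e ++ [ 0 ]))          ≡⟨ cong (map F) (below-∷ʳ-0 e) ⟩
  map F (map (_++ [ 0 ]) (below e))   ≡⟨ LP.map-∘ (below e) ⟨
  map (F ∘ (_++ [ 0 ])) (below e)     ≡⟨ LP.map-cong-local (All.map {Q = λ x → F (x ++ [ 0 ]) ≡ G x}
                                          (λ {x} el → pointwise {x} el) (length-below e)) ⟩
  map G (below e)                     ∎)
  where
  open ≡-Reasoning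
  F = λ e₁ → xpow a e₁ *Q monomialSym (ℓ ∸ 1) λ′ (zipWith _∸_ (e ++ [ 0 ]) e₁)
  G = λ e₁ → xpow a e₁ *Q monomialSym (ℓ ∸ 1) λ′ (zipWith _∸_ e e₁)
  pointwise : ∀ {x} → length x ≡ length e → F (x ++ [ 0 ]) ≡ G x
  pointwise {x} el rewrite strip-∷ʳ-0 x | zipWith-++ _∸_ e x [ 0 ] [ 0 ] el
                         | monomialSym-∷ʳ-0 (ℓ ∸ 1) λ′ (zipWith _∸_ e x) = refl

≤ᵇ-true⇒≤ : ∀ a b → (a ≤ᵇ b) ≡ true → a ≤ b
≤ᵇ-true⇒≤ a b e = ℕP.≤ᵇ⇒≤ a b (subst T (sym e) tt)

≤ᵇ-false⇒> : ∀ a b → (a ≤ᵇ b) ≡ false → b < a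
≤ᵇ-false⇒> a b e = ℕP.≰⇒> (λ a≤b → subst T e (ℕP.≤⇒≤ᵇ a≤b))

≤⇒≤ᵇ-true : ∀ {a b} → a ≤ b → (a ≤ᵇ b) ≡ true
≤⇒≤ᵇ-true {a} {b} le with a ≤ᵇ b in e
... | true = refl
... | false = ⊥-elim (ℕP.<⇒≱ (≤ᵇ-false⇒> a b e) le)

insertDesc-↭ : ∀ x s → insertDesc x s ↭ x ∷ s
insertDesc-↭ x [] = ↭.refl
insertDesc-↭ x (y ∷ s) with y ≤ᵇ x
... | true = ↭.refl
... | false = ↭.trans (↭.prep y (insertDesc-↭ x s)) (↭.swap y x ↭.refl)

sortDesc-↭ : ∀ l → sortDesc l ↭ l
sortDesc-↭ [] = ↭.refl
sortDesc-↭ (x ∷ l) = ↭.trans (insertDesc-↭ x (sortDesc l)) (↭.prep x (sortDesc-↭ l))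

insertDesc-sorted : ∀ x s → Linked _≥_ s → Linked _≥_ (insertDesc x s)
insertDesc-sorted x [] _ = [-]
insertDesc-sorted x (y ∷ s) L with y ≤ᵇ x in e
... | true = ≤ᵇ-true⇒≤ y x e ∷ L
insertDesc-sorted x (y ∷ []) [-] | false = ℕP.<⇒≤ (≤ᵇ-false⇒> y x e) ∷ [-]
insertDesc-sorted x (y ∷ z ∷ s) (y≥z ∷ L) | false with z ≤ᵇ x | insertDesc-sorted x (z ∷ s) L
... | true | L' = ℕP.<⇒≤ (≤ᵇ-false⇒> y x e) ∷ L'
... | false | L' = y≥z ∷ L'

sortDesc-sorted : ∀ l → Linked _≥_ (sortDesc l)
sortDesc-sorted [] = []
sortDesc-sorted (x ∷ l) = insertDesc-sorted x (sortDesc l) (sortDesc-sorted l)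

sortDesc-sorted-id : ∀ l → Linked _≥_ l → sortDesc l ≡ l
sortDesc-sorted-id [] _ = refl
sortDesc-sorted-id (x ∷ []) _ = refl
sortDesc-sorted-id (x ∷ y ∷ l) (x≥y ∷ L) rewrite sortDesc-sorted-id (y ∷ l) L | ≤⇒≤ᵇ-true x≥y = refl

sum-sortDesc : ∀ l → sum (sortDesc l) ≡ sum l
sum-sortDesc l = SumP.sum-↭ (sortDesc-↭ l)

All-sortDesc : ∀ {P : ℕ → Set} l → All P l → All P (sortDesc l)
All-sortDesc l = ↭P.All-resp-↭ (↭-sym (sortDesc-↭ l))

multiplicity : ℕ → List ℕ → ℕ
multiplicity v [] = 0
multiplicity v (x ∷ l) = (if v ≡ᵇ x then 1 else 0) + multiplicity v l

multiplicity-++ : ∀ v X Y → multiplicity v (X ++ Y) ≡ multiplicity v X + multiplicity v Y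
multiplicity-++ v [] Y = refl
multiplicity-++ v (x ∷ X) Y rewrite multiplicity-++ v X Y =
  sym (ℕP.+-assoc (if v ≡ᵇ x then 1 else 0) (multiplicity v X) (multiplicity v Y))

multiplicity-↭ : ∀ v {l l'} → l ↭ l' → multiplicity v l ≡ multiplicity v l'
multiplicity-↭ v ↭.refl = refl
multiplicity-↭ v (↭.prep x p) = cong ((if v ≡ᵇ x then 1 else 0) +_) (multiplicity-↭ v p)
multiplicity-↭ v {x ∷ y ∷ xs} {_ ∷ _ ∷ ys} (↭.swap x y p) = trans
  (sym (ℕP.+-assoc [v≡x] [v≡y] (multiplicity v xs)))
  (trans (cong₂ _+_ (ℕP.+-comm [v≡x] [v≡y]) (multiplicity-↭ v p))
         (ℕP.+-assoc [v≡y] [v≡x] (multiplicity v ys)))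
  where [v≡x] = if v ≡ᵇ x then 1 else 0
        [v≡y] = if v ≡ᵇ y then 1 else 0
multiplicity-↭ v (↭.trans p q) = trans (multiplicity-↭ v p) (multiplicity-↭ v q)

head-≥ : ∀ v y ys → Linked _≥_ (y ∷ ys) → 1 ≤ multiplicity v (y ∷ ys) → v ≤ y
head-≥ v y ys L c with v ≡ᵇ y in e
... | true = ℕP.≤-reflexive (≡ᵇ-true⇒≡ v y e)
head-≥ v y [] L () | false
head-≥ v y (z ∷ zs) (y≥z ∷ L) c | false = ℕP.≤-trans (head-≥ v z zs L c) y≥z

linked-tail : ∀ {x xs} → Linked _≥_ (x ∷ xs) → Linked _≥_ xs
linked-tail [-] = []
linked-tail (_ ∷ L) = L

multiplicity-head : ∀ x xs → 1 ≤ multiplicity x (x ∷ xs)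
multiplicity-head x xs rewrite ≡ᵇ-refl x = s≤s z≤n

sorted-unique : ∀ s s' → Linked _≥_ s → Linked _≥_ s' →
  (∀ v → multiplicity v s ≡ multiplicity v s') → s ≡ s'
sorted-unique [] [] _ _ _ = refl
sorted-unique [] (y ∷ ys) _ _ c = ⊥-elim (ℕP.1+n≰n (subst (1 ≤_) (sym (c y)) (multiplicity-head y ys)))
sorted-unique (x ∷ xs) [] _ _ c = ⊥-elim (ℕP.1+n≰n (subst (1 ≤_) (c x) (multiplicity-head x xs)))
sorted-unique (x ∷ xs) (y ∷ ys) L L' c
  with ℕP.≤-antisym (head-≥ x y ys L' (subst (1 ≤_) (c x) (multiplicity-head x xs)))
                    (head-≥ y x xs L (subst (1 ≤_) (sym (c y)) (multiplicity-head y ys)))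
... | refl = cong (x ∷_) (sorted-unique xs ys (linked-tail L) (linked-tail L')
               (λ v → ℕP.+-cancelˡ-≡ (if v ≡ᵇ x then 1 else 0) (multiplicity v xs) (multiplicity v ys) (c v)))

sortDesc-multiplicity : ∀ l l' → (∀ v → multiplicity v l ≡ multiplicity v l') → sortDesc l ≡ sortDesc l'
sortDesc-multiplicity l l' c = sorted-unique (sortDesc l) (sortDesc l') (sortDesc-sorted l) (sortDesc-sorted l')
  (λ v → trans (multiplicity-↭ v (sortDesc-↭ l)) (trans (c v) (sym (multiplicity-↭ v (sortDesc-↭ l')))))

sortDesc-resp-↭ : ∀ {l l'} → l ↭ l' → sortDesc l ≡ sortDesc l'
sortDesc-resp-↭ {l} {l'} p = sortDesc-multiplicity l l' (λ v → multiplicity-↭ v p)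

positives-++ : ∀ X Y → positives (X ++ Y) ≡ positives X ++ positives Y
positives-++ [] Y = refl
positives-++ (zero ∷ X) Y = positives-++ X Y
positives-++ (suc x ∷ X) Y = cong (suc x ∷_) (positives-++ X Y)

positives-all : ∀ l → All (0 <_) l → positives l ≡ l
positives-all [] _ = refl
positives-all (suc x ∷ l) (_ ∷ a) = cong (suc x ∷_) (positives-all l a)

positives-positive : ∀ l → All (0 <_) (positives l)
positives-positive [] = []
positives-positive (zero ∷ l) = positives-positive l
positives-positive (suc x ∷ l) = s≤s z≤n ∷ positives-positive l

sum-positives : ∀ l → sum (positives l) ≡ sum l
sum-positives [] = refl
sum-positives (zero ∷ l) = sum-positives l
sum-positives (suc x ∷ l) = cong (suc x +_) (sum-positives l)

positives-zeros : ∀ l → All (_≡ 0) l → positives l ≡ []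
positives-zeros [] _ = refl
positives-zeros (zero ∷ l) (_ ∷ a) = positives-zeros l a

multiplicity-positives : ∀ v l → multiplicity v (positives l) ≡ (if 1 ≤ᵇ v then multiplicity v l else 0)
multiplicity-positives zero [] = refl
multiplicity-positives (suc v) [] = refl
multiplicity-positives zero (zero ∷ l) = multiplicity-positives zero l
multiplicity-positives (suc v) (zero ∷ l) = multiplicity-positives (suc v) l
multiplicity-positives zero (suc x ∷ l) = multiplicity-positives zero l
multiplicity-positives (suc v) (suc x ∷ l) =
  cong ((if v ≡ᵇ x then 1 else 0) +_) (multiplicity-positives (suc v) l)

shape : List ℕ → List ℕ
shape r = sortDesc (positives r)

shape-partition : ∀ r → IsPartition (shape r)
shape-partition r = All-sortDesc (positives r) (positives-positive r) , sortDesc-sorted (positives r)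

shape-partition-id : ∀ μ → IsPartition μ → shape μ ≡ μ
shape-partition-id μ (pos , sorted) = trans (cong sortDesc (positives-all μ pos)) (sortDesc-sorted-id μ sorted)

sum-shape : ∀ r → sum (shape r) ≡ sum r
sum-shape r = trans (sum-sortDesc (positives r)) (sum-positives r)

shape-multiplicity : ∀ l l' → (∀ v → multiplicity v l ≡ multiplicity v l') → shape l ≡ shape l'
shape-multiplicity l l' c = sortDesc-multiplicity (positives l) (positives l')
  (λ v → trans (multiplicity-positives v l) (trans (cong (λ n → if 1 ≤ᵇ v then n else 0) (c v))
                                                     (sym (multiplicity-positives v l'))))

shape-++-shape : ∀ Y r → shape (Y ++ r) ≡ shape (Y ++ shape r)
shape-++-shape Y r = begin
  sortDesc (positives (Y ++ r))                     ≡⟨ cong sortDesc (positives-++ Y r) ⟩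
  sortDesc (positives Y ++ positives r)             ≡⟨ sortDesc-resp-↭ (↭P.++⁺ˡ (positives Y) (↭-sym (sortDesc-↭ (positives r)))) ⟩
  sortDesc (positives Y ++ shape r)                 ≡⟨ cong (λ s → sortDesc (positives Y ++ s)) (positives-all (shape r) (proj₁ (shape-partition r))) ⟨
  sortDesc (positives Y ++ positives (shape r))     ≡⟨ cong sortDesc (positives-++ Y (shape r)) ⟨
  sortDesc (positives (Y ++ shape r))               ∎
  where open ≡-Reasoning

-- An m-symmetric function sees a monomial only through its first m exponents and the
-- partition formed by the others.
headExponents : (m : ℕ) → Mono → Vec ℕ m
headExponents zero e = []v
headExponents (suc m) [] = 0 ∷v headExponents m []
headExponents (suc m) (x ∷ e) = x ∷v headExponents m e

toList-injective : ∀ {m} (u w : Vec ℕ m) → toList u ≡ toList w → u ≡ w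
toList-injective []v []v _ = refl
toList-injective (x ∷v u) (y ∷v w) e = cong₂ _∷v_ (LP.∷-injectiveˡ e) (toList-injective u w (LP.∷-injectiveʳ e))

tailShape : ℕ → Mono → List ℕ
tailShape m e = shape (drop m e)

canonical : ∀ {m} → Vec ℕ m × List ℕ → Mono
canonical (a , μ) = toList a ++ μ

headExponents-padding : ∀ m e → ∃ λ j → e ++ replicate j 0 ≡ toList (headExponents m e) ++ drop m e
headExponents-padding zero e = 0 , LP.++-identityʳ e
headExponents-padding (suc m) [] with headExponents-padding m []
... | j , eq = suc j , cong (0 ∷_) (trans eq (cong (toList (headExponents m []) ++_) (LP.drop-[] m)))
headExponents-padding (suc m) (x ∷ e) with headExponents-padding m e
... | j , eq = j , cong (x ∷_) eq

sum-headExponents-tailShape : ∀ m e → sum e ≡ sum (toList (headExponents m e)) + sum (tailShape m e)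
sum-headExponents-tailShape m e with headExponents-padding m e
... | j , eq = begin
  sum e                                          ≡⟨ ℕP.+-identityʳ (sum e) ⟨
  sum e + 0                                      ≡⟨ cong (sum e +_) (sum-replicate-0 j) ⟨
  sum e + sum (replicate j 0)                    ≡⟨ SumP.sum-++ e (replicate j 0) ⟨
  sum (e ++ replicate j 0)                       ≡⟨ cong sum eq ⟩
  sum (toList U ++ drop m e)                     ≡⟨ SumP.sum-++ (toList U) (drop m e) ⟩
  sum (toList U) + sum (drop m e)                ≡⟨ cong (sum (toList U) +_) (sum-shape (drop m e)) ⟨
  sum (toList U) + sum (tailShape m e)           ∎
  where open ≡-Reasoning
        U = headExponents m e
        sum-replicate-0 : ∀ j → sum (replicate j 0) ≡ 0
        sum-replicate-0 zero = refl
        sum-replicate-0 (suc j) = sum-replicate-0 j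

≤ᴹ-++ : ∀ A U Z r → length A ≡ length U → ((A ++ Z) ≤ᴹ (U ++ r)) ≡ (A ≤ᴹ U) ∧ (Z ≤ᴹ r)
≤ᴹ-++ [] [] Z r _ = refl
≤ᴹ-++ (a ∷ A) (b ∷ U) Z r el rewrite ≤ᴹ-++ A U Z r (ℕP.suc-injective el) =
  sym (BoolP.∧-assoc (a <ᵇ suc b) (A ≤ᴹ U) (Z ≤ᴹ r))

replicate-0-≤ᴹ : ∀ r → (replicate (length r) 0 ≤ᴹ r) ≡ true
replicate-0-≤ᴹ [] = refl
replicate-0-≤ᴹ (x ∷ r) = replicate-0-≤ᴹ r

zipWith-∸-replicate-0 : ∀ r → zipWith _∸_ r (replicate (length r) 0) ≡ r
zipWith-∸-replicate-0 [] = refl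
zipWith-∸-replicate-0 (x ∷ r) = cong (x ∷_) (zipWith-∸-replicate-0 r)

take-++-≤ : ∀ k (X r : List ℕ) → k ≤ length X → take k (X ++ r) ≡ take k X
take-++-≤ zero X r _ = refl
take-++-≤ (suc k) (x ∷ X) r (s≤s le) = cong (x ∷_) (take-++-≤ k X r le)

drop-++-≤ : ∀ k (X r : List ℕ) → k ≤ length X → drop k (X ++ r) ≡ drop k X ++ r
drop-++-≤ zero X r _ = refl
drop-++-≤ (suc k) (x ∷ X) r (s≤s le) = drop-++-≤ k X r le

length-zipWith-∸ : ∀ (U A : List ℕ) → length U ≡ length A → length (zipWith _∸_ U A) ≡ length U
length-zipWith-∸ [] [] _ = refl
length-zipWith-∸ (x ∷ U) (y ∷ A) e = cong suc (length-zipWith-∸ U A (ℕP.suc-injective e))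

module Values (m ℓ : ℕ) (ℓ-1≤m : ℓ ∸ 1 ≤ m) where

  k : ℕ
  k = ℓ ∸ 1

  monomialSymᵇ : List ℕ → Mono → Bool
  monomialSymᵇ λ′ y = and (map (_≡ᵇ 0) (take k y)) ∧ (shape (drop k y) ==ᴹ λ′)

  -- Whether x^A m_λ(x_ℓ, …) has the monomial with head exponents U and tail of shape c:
  -- x^A divides x^U, the quotient has no x_1, …, x_{ℓ-1}, and its remaining exponents
  -- together with c form λ.
  occurs : List ℕ → List ℕ → List ℕ → List ℕ → Bool
  occurs A λ′ U c = (A ≤ᴹ U) ∧ (and (map (_≡ᵇ 0) (take k (zipWith _∸_ U A)))
                                ∧ (shape (drop k (zipWith _∸_ U A) ++ c) ==ᴹ λ′))

  -- The coefficient of x^e in x^a · m_λ is a sum over the divisors x^e₁ of x^e in which only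
  -- e₁ = a (padded with zeros) can contribute.
  basisElem-padded : ∀ (a : Vec ℕ m) λ′ (u : Vec ℕ m) r →
    basisElem m ℓ a λ′ (toList u ++ r) ≡
      indicator (((toList a ++ replicate (length r) 0) ≤ᴹ (toList u ++ r))
                 ∧ monomialSymᵇ λ′ (zipWith _∸_ (toList u ++ r) (toList a ++ replicate (length r) 0)))
  basisElem-padded a λ′ u r = begin
    sumQ (map F (below e))
      ≡⟨ cong sumQ (LP.map-cong-local (All.map {Q = λ x → F x ≡ indicator ((x ==ᴹ D₀) ∧ G x)}
                                                 (λ {x} el → term x el) (length-below e))) ⟩
    sumQ (map (λ x → indicator ((x ==ᴹ D₀) ∧ G x)) (below e))
      ≡⟨ cong sumQ (LP.map-∘ (below e)) ⟩
    sumQ (map indicator (map (λ x → (x ==ᴹ D₀) ∧ G x) (below e)))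
      ≡⟨ sumQ-indicators (map (λ x → (x ==ᴹ D₀) ∧ G x) (below e))
           (ℕP.≤-trans (countTrue-map-==ᴹ-∧ D₀ G (below e)) (countTrue-below e D₀)) ⟩
    indicator (or (map (λ x → (x ==ᴹ D₀) ∧ G x) (below e)))
      ≡⟨ cong indicator (or-map-==ᴹ-∧ D₀ G (below e)) ⟩
    indicator (or (map (_==ᴹ D₀) (below e)) ∧ G D₀)
      ≡⟨ cong (λ b → indicator (b ∧ G D₀)) (or-below e D₀) ⟩
    indicator ((D₀ ≤ᴹ e) ∧ G D₀) ∎
    where
    open ≡-Reasoning
    e = toList u ++ r
    D₀ = toList a ++ replicate (length r) 0
    F = λ e₁ → xpow a e₁ *Q monomialSym k λ′ (zipWith _∸_ e e₁)
    G = λ x → monomialSymᵇ λ′ (zipWith _∸_ e x)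
    |e|≡|D₀| : length e ≡ length D₀
    |e|≡|D₀| = trans (LP.length-++ (toList u))
      (trans (cong₂ _+_ (trans (VecP.length-toList u) (sym (VecP.length-toList a))) (sym (LP.length-replicate (length r))))
             (sym (LP.length-++ (toList a))))
    term : ∀ x → length x ≡ length e → F x ≡ indicator ((x ==ᴹ D₀) ∧ G x)
    term x el = trans (indicator-∧ (strip x ==ᴹ strip (toList a)) (G x))
      (cong (λ b → indicator (b ∧ G x)) (==ᴹ-strip x (toList a) (length r) (trans el |e|≡|D₀|)))

  basisElem-split : ∀ (a : Vec ℕ m) λ′ (u : Vec ℕ m) r →
    basisElem m ℓ a λ′ (toList u ++ r) ≡ indicator (occurs (toList a) λ′ (toList u) (shape r))
  basisElem-split a λ′ u r = trans (basisElem-padded a λ′ u r) (cong indicator (begin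
    ((A ++ Z) ≤ᴹ (U ++ r)) ∧ monomialSymᵇ λ′ (zipWith _∸_ (U ++ r) (A ++ Z))
      ≡⟨ cong₂ _∧_ (trans (≤ᴹ-++ A U Z r |A|≡|U|) (trans (cong ((A ≤ᴹ U) ∧_) (replicate-0-≤ᴹ r)) (BoolP.∧-identityʳ _)))
                   (cong (monomialSymᵇ λ′) (trans (zipWith-++ _∸_ U A r Z |A|≡|U|) (cong (D ++_) (zipWith-∸-replicate-0 r)))) ⟩
    (A ≤ᴹ U) ∧ monomialSymᵇ λ′ (D ++ r)
      ≡⟨ cong ((A ≤ᴹ U) ∧_) (cong₂ _∧_ (cong (and ∘ map (_≡ᵇ 0)) (take-++-≤ k D r k≤|D|))
            (cong (_==ᴹ λ′) (trans (cong shape (drop-++-≤ k D r k≤|D|)) (shape-++-shape (drop k D) r)))) ⟩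
    occurs A λ′ U (shape r) ∎))
    where
    open ≡-Reasoning
    A = toList a
    U = toList u
    Z = replicate (length r) 0
    D = zipWith _∸_ U A
    |A|≡|U| : length A ≡ length U
    |A|≡|U| = trans (VecP.length-toList a) (sym (VecP.length-toList u))
    k≤|D| : k ≤ length D
    k≤|D| = subst (k ≤_) (sym (trans (length-zipWith-∸ U A (sym |A|≡|U|)) (VecP.length-toList u))) ℓ-1≤m

  basisElem≡indicator : ∀ (a : Vec ℕ m) λ′ e →
    basisElem m ℓ a λ′ e ≡ indicator (occurs (toList a) λ′ (toList (headExponents m e)) (tailShape m e))
  basisElem≡indicator a λ′ e with headExponents-padding m e
  ... | j , eq = trans (sym (++-replicate-0-invariant (basisElem m ℓ a λ′) (basisElem-∷ʳ-0 m ℓ a λ′) e j))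
                 (trans (cong (basisElem m ℓ a λ′) eq) (basisElem-split a λ′ (headExponents m e) (drop m e)))

  basisElem-canonical : ∀ (a : Vec ℕ m) λ′ (a' : Vec ℕ m) μ → IsPartition μ →
    basisElem m ℓ a λ′ (canonical (a' , μ)) ≡ indicator (occurs (toList a) λ′ (toList a') μ)
  basisElem-canonical a λ′ a' μ P =
    trans (basisElem-split a λ′ a' μ) (cong (λ c → indicator (occurs (toList a) λ′ (toList a') c)) (shape-partition-id μ P))

  valid-basisElem : ∀ (a : Vec ℕ m) λ′ e → ValidQ (basisElem m ℓ a λ′ e)
  valid-basisElem a λ′ e =
    subst ValidQ (sym (basisElem≡indicator a λ′ e))
      (valid-indicator (occurs (toList a) λ′ (toList (headExponents m e)) (tailShape m e)))

  basisElem-≡0Q : ∀ (a : Vec ℕ m) λ′ e →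
    (occurs (toList a) λ′ (toList (headExponents m e)) (tailShape m e) ≡ true → ⊥) → basisElem m ℓ a λ′ e ≡ 0Q
  basisElem-≡0Q a λ′ e ¬occ = trans (basisElem≡indicator a λ′ e) (indicator≡0Q _ refl)
    where
    indicator≡0Q : ∀ b → occurs (toList a) λ′ (toList (headExponents m e)) (tailShape m e) ≡ b → indicator b ≡ 0Q
    indicator≡0Q false _ = refl
    indicator≡0Q true occ = ⊥-elim (¬occ occ)

<ᵇ-suc-self : ∀ n → (n <ᵇ suc n) ≡ true
<ᵇ-suc-self zero = refl
<ᵇ-suc-self (suc n) = <ᵇ-suc-self n

<ᵇ-suc⇒≤ : ∀ a b → (a <ᵇ suc b) ≡ true → a ≤ b
<ᵇ-suc⇒≤ a b e = ℕP.≤-pred (ℕP.<ᵇ⇒< a (suc b) (subst T (sym e) tt))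

≤ᴹ-refl : ∀ A → (A ≤ᴹ A) ≡ true
≤ᴹ-refl [] = refl
≤ᴹ-refl (a ∷ A) rewrite <ᵇ-suc-self a = ≤ᴹ-refl A

zipWith-∸-self : ∀ A → zipWith _∸_ A A ≡ replicate (length A) 0
zipWith-∸-self [] = refl
zipWith-∸-self (a ∷ A) = cong₂ _∷_ (ℕP.n∸n≡0 a) (zipWith-∸-self A)

and-take-replicate-0 : ∀ k n → and (map (_≡ᵇ 0) (take k (replicate n 0))) ≡ true
and-take-replicate-0 zero n = refl
and-take-replicate-0 (suc k) zero = refl
and-take-replicate-0 (suc k) (suc n) = and-take-replicate-0 k n

drop-replicate-0 : ∀ k n → All (_≡ 0) (drop k (replicate n 0))
drop-replicate-0 zero zero = []
drop-replicate-0 zero (suc n) = refl ∷ drop-replicate-0 zero n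
drop-replicate-0 (suc k) zero = []
drop-replicate-0 (suc k) (suc n) = drop-replicate-0 k n

and-≡ᵇ0⇒zeros : ∀ l → and (map (_≡ᵇ 0) l) ≡ true → All (_≡ 0) l
and-≡ᵇ0⇒zeros [] _ = []
and-≡ᵇ0⇒zeros (zero ∷ l) e = refl ∷ and-≡ᵇ0⇒zeros l e

sum-zeros : ∀ l → All (_≡ 0) l → sum l ≡ 0
sum-zeros [] _ = refl
sum-zeros (zero ∷ l) (_ ∷ a) = sum-zeros l a

sum≡0⇒zeros : ∀ l → sum l ≡ 0 → All (_≡ 0) l
sum≡0⇒zeros [] _ = []
sum≡0⇒zeros (zero ∷ l) e = refl ∷ sum≡0⇒zeros l e

≤ᴹ⇒sum : ∀ A U → (A ≤ᴹ U) ≡ true → sum U ≡ sum A + sum (zipWith _∸_ U A)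
≤ᴹ⇒sum [] [] _ = refl
≤ᴹ⇒sum (a ∷ A) (b ∷ U) e with a <ᵇ suc b in a≤b
... | true rewrite ≤ᴹ⇒sum A U e = begin
    b + (sum A + sum D)              ≡⟨ cong (_+ (sum A + sum D)) (ℕP.m+[n∸m]≡n (<ᵇ-suc⇒≤ a b a≤b)) ⟨
    (a + (b ∸ a)) + (sum A + sum D)  ≡⟨ +-interchange a (b ∸ a) (sum A) (sum D) ⟩
    a + sum A + (b ∸ a + sum D)      ∎
  where open ≡-Reasoning
        D = zipWith _∸_ U A
≤ᴹ⇒sum (a ∷ A) (b ∷ U) () | false

≤ᴹ-zeros⇒≡ : ∀ A U → (A ≤ᴹ U) ≡ true → All (_≡ 0) (zipWith _∸_ U A) → A ≡ U
≤ᴹ-zeros⇒≡ [] [] _ _ = refl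
≤ᴹ-zeros⇒≡ (a ∷ A) (b ∷ U) e (b∸a≡0 ∷ zs) with a <ᵇ suc b in a≤b
... | true = cong₂ _∷_ (ℕP.≤-antisym (<ᵇ-suc⇒≤ a b a≤b) (ℕP.m∸n≡0⇒m≤n b∸a≡0)) (≤ᴹ-zeros⇒≡ A U e zs)
≤ᴹ-zeros⇒≡ (a ∷ A) (b ∷ U) () _ | false

module Occurrence (m ℓ : ℕ) (ℓ-1≤m : ℓ ∸ 1 ≤ m) where
  open Values m ℓ ℓ-1≤m

  occurs-self : ∀ A λ′ → IsPartition λ′ → occurs A λ′ A λ′ ≡ true
  occurs-self A λ′ P@(pos , _)
    rewrite ≤ᴹ-refl A | zipWith-∸-self A | and-take-replicate-0 k (length A)
          | positives-++ (drop k (replicate (length A) 0)) λ′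
          | positives-zeros (drop k (replicate (length A) 0)) (drop-replicate-0 k (length A))
          | positives-all λ′ pos | sortDesc-sorted-id λ′ (proj₂ P) = ==ᴹ-refl λ′

  record Occurrence (A λ′ U c : List ℕ) : Set where
    field
      divides : (A ≤ᴹ U) ≡ true
      head-free : All (_≡ 0) (take k (zipWith _∸_ U A))
      tail-shape : shape (drop k (zipWith _∸_ U A) ++ c) ≡ λ′

  occurs⇒Occurrence : ∀ A λ′ U c → occurs A λ′ U c ≡ true → Occurrence A λ′ U c
  occurs⇒Occurrence A λ′ U c e = record
    { divides = BoolP.∧-conicalˡ (A ≤ᴹ U) (b₂ ∧ b₃) e
    ; head-free = and-≡ᵇ0⇒zeros (take k D) (BoolP.∧-conicalˡ b₂ b₃ (BoolP.∧-conicalʳ (A ≤ᴹ U) (b₂ ∧ b₃) e))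
    ; tail-shape = ==ᴹ⇒≡ _ λ′ (BoolP.∧-conicalʳ b₂ b₃ (BoolP.∧-conicalʳ (A ≤ᴹ U) (b₂ ∧ b₃) e)) }
    where D = zipWith _∸_ U A
          b₂ = and (map (_≡ᵇ 0) (take k D))
          b₃ = shape (drop k D ++ c) ==ᴹ λ′

  occurs-degree : ∀ A λ′ U c → occurs A λ′ U c ≡ true → sum U + sum c ≡ sum A + sum λ′
  occurs-degree A λ′ U c e = begin
    sum U + sum c                                    ≡⟨ cong (_+ sum c) (≤ᴹ⇒sum A U divides) ⟩
    sum A + sum D + sum c                            ≡⟨ cong (λ z → sum A + z + sum c) sum-D ⟩
    sum A + sum (drop k D) + sum c                   ≡⟨ ℕP.+-assoc (sum A) (sum (drop k D)) (sum c) ⟩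
    sum A + (sum (drop k D) + sum c)                 ≡⟨ cong (sum A +_) (SumP.sum-++ (drop k D) c) ⟨
    sum A + sum (drop k D ++ c)                      ≡⟨ cong (sum A +_) (sum-shape (drop k D ++ c)) ⟨
    sum A + sum (shape (drop k D ++ c))              ≡⟨ cong (λ s → sum A + sum s) tail-shape ⟩
    sum A + sum λ′                                   ∎
    where
    open ≡-Reasoning
    open Occurrence (occurs⇒Occurrence A λ′ U c e)
    D = zipWith _∸_ U A
    sum-D : sum D ≡ sum (drop k D)
    sum-D = begin
      sum D                               ≡⟨ cong sum (LP.take++drop≡id k D) ⟨
      sum (take k D ++ drop k D)          ≡⟨ SumP.sum-++ (take k D) (drop k D) ⟩
      sum (take k D) + sum (drop k D)     ≡⟨ cong (_+ sum (drop k D)) (sum-zeros (take k D) head-free) ⟩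
      sum (drop k D)                      ∎

  occurs-triangular : ∀ A A' λ′ μ → IsPartition μ → occurs A λ′ A' μ ≡ true →
    (A ≡ A' × λ′ ≡ μ) ⊎ sum μ < sum λ′
  occurs-triangular A A' λ′ μ P@(pos , _) e with sum (drop k D) ℕ.≟ 0
    where D = zipWith _∸_ A' A
  ... | no nz = inj₂ (begin-strict
      sum μ                          <⟨ ℕP.m<n+m (sum μ) (ℕP.n≢0⇒n>0 nz) ⟩
      sum (drop k D) + sum μ         ≡⟨ SumP.sum-++ (drop k D) μ ⟨
      sum (drop k D ++ μ)            ≡⟨ sum-shape (drop k D ++ μ) ⟨
      sum (shape (drop k D ++ μ))    ≡⟨ cong sum tail-shape ⟩
      sum λ′                         ∎)
    where
    open ℕP.≤-Reasoning
    open Occurrence (occurs⇒Occurrence A λ′ A' μ e)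
    D = zipWith _∸_ A' A
  ... | yes z = inj₁ (≤ᴹ-zeros⇒≡ A A' divides D-zeros , λ′≡μ)
    where
    open Occurrence (occurs⇒Occurrence A λ′ A' μ e)
    D = zipWith _∸_ A' A
    D-zeros : All (_≡ 0) D
    D-zeros = subst (All (_≡ 0)) (LP.take++drop≡id k D) (AllP.++⁺ head-free (sum≡0⇒zeros (drop k D) z))
    λ′≡μ : λ′ ≡ μ
    λ′≡μ = begin
      λ′                                   ≡⟨ tail-shape ⟨
      shape (drop k D ++ μ)                ≡⟨ cong sortDesc (positives-++ (drop k D) μ) ⟩
      sortDesc (positives (drop k D) ++ positives μ)
        ≡⟨ cong (λ z → sortDesc (z ++ positives μ)) (positives-zeros (drop k D) (sum≡0⇒zeros (drop k D) z)) ⟩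
      shape μ                              ≡⟨ shape-partition-id μ P ⟩
      μ                                    ∎
      where open ≡-Reasoning

module TailSymmetry where
  module ℕSum = CommutativeMonoidSum ℕP.+-0-commutativeMonoid

  headExponents-lookup : ∀ m {N} (v w : Vec ℕ N) → (∀ i → toℕ i < m → lookup v i ≡ lookup w i) →
    headExponents m (toList v) ≡ headExponents m (toList w)
  headExponents-lookup zero v w h = refl
  headExponents-lookup (suc m) []v []v h = refl
  headExponents-lookup (suc m) (x ∷v v) (y ∷v w) h =
    cong₂ _∷v_ (h fzero (s≤s z≤n)) (headExponents-lookup m v w (λ i lt → h (fsuc i) (s≤s lt)))

  take-lookup : ∀ m {N} (v w : Vec ℕ N) → (∀ i → toℕ i < m → lookup v i ≡ lookup w i) →
    take m (toList v) ≡ take m (toList w)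
  take-lookup zero v w h = refl
  take-lookup (suc m) []v []v h = refl
  take-lookup (suc m) (x ∷v v) (y ∷v w) h =
    cong₂ _∷_ (h fzero (s≤s z≤n)) (take-lookup m v w (λ i lt → h (fsuc i) (s≤s lt)))

  multiplicity-toList : ∀ v {N} (u : Vec ℕ N) →
    multiplicity v (toList u) ≡ ℕSum.sum (λ i → if v ≡ᵇ lookup u i then 1 else 0)
  multiplicity-toList v []v = refl
  multiplicity-toList v (x ∷v u) = cong ((if v ≡ᵇ x then 1 else 0) +_) (multiplicity-toList v u)

  multiplicity-permuteV : ∀ v {N} (π : Permutation′ N) (w : Vec ℕ N) →
    multiplicity v (toList (permuteV π w)) ≡ multiplicity v (toList w)
  multiplicity-permuteV v π w = trans (multiplicity-toList v (permuteV π w))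
    (trans (ℕSum.sum-cong-≗ (λ i → cong (λ x → if v ≡ᵇ x then 1 else 0)
                                        (VecP.lookup∘tabulate (λ j → lookup w (π ⟨$⟩ʳ j)) i)))
    (trans (sym (ℕSum.sum-permute (λ i → if v ≡ᵇ lookup w i then 1 else 0) π))
           (sym (multiplicity-toList v w))))

  module _ (m : ℕ) {N} (π : Permutation′ N) (fixes : ∀ i → toℕ i < m → π ⟨$⟩ʳ i ≡ i) (w : Vec ℕ N) where

    private
      lookup-head : ∀ i → toℕ i < m → lookup (permuteV π w) i ≡ lookup w i
      lookup-head i lt = trans (VecP.lookup∘tabulate (λ j → lookup w (π ⟨$⟩ʳ j)) i) (cong (lookup w) (fixes i lt))

      pw = toList (permuteV π w)

    headExponents-permuteV : headExponents m pw ≡ headExponents m (toList w)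
    headExponents-permuteV = headExponents-lookup m (permuteV π w) w lookup-head

    tailShape-permuteV : tailShape m pw ≡ tailShape m (toList w)
    tailShape-permuteV = shape-multiplicity (drop m pw) (drop m (toList w)) λ v →
      ℕP.+-cancelˡ-≡ (multiplicity v (take m (toList w))) _ _ (begin
        multiplicity v (take m (toList w)) + multiplicity v (drop m pw)
          ≡⟨ cong (λ z → multiplicity v z + multiplicity v (drop m pw)) (take-lookup m (permuteV π w) w lookup-head) ⟨
        multiplicity v (take m pw) + multiplicity v (drop m pw)
          ≡⟨ multiplicity-++ v (take m pw) (drop m pw) ⟨
        multiplicity v (take m pw ++ drop m pw)
          ≡⟨ cong (multiplicity v) (LP.take++drop≡id m pw) ⟩
        multiplicity v pw
          ≡⟨ multiplicity-permuteV v π w ⟩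
        multiplicity v (toList w)
          ≡⟨ cong (multiplicity v) (LP.take++drop≡id m (toList w)) ⟨
        multiplicity v (take m (toList w) ++ drop m (toList w))
          ≡⟨ multiplicity-++ v (take m (toList w)) (drop m (toList w)) ⟩
        multiplicity v (take m (toList w)) + multiplicity v (drop m (toList w)) ∎)
      where open ≡-Reasoning

open TailSymmetry using (headExponents-permuteV; tailShape-permuteV)

module BasisElements (m ℓ : ℕ) (ℓ-1≤m : ℓ ∸ 1 ≤ m) where
  open Values m ℓ ℓ-1≤m
  open Occurrence m ℓ ℓ-1≤m

  basisElem-degree : ∀ (a : Vec ℕ m) λ′ e → occurs (toList a) λ′ (toList (headExponents m e)) (tailShape m e) ≡ true →
    sum e ≡ sum (toList a) + sum λ′
  basisElem-degree a λ′ e occ =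
    trans (sum-headExponents-tailShape m e)
          (occurs-degree (toList a) λ′ (toList (headExponents m e)) (tailShape m e) occ)

  basisElem∈R : ∀ a λ′ → IsPartition λ′ → InR m (basisElem m ℓ a λ′)
  basisElem∈R a λ′ _ = (∷ʳ-0-invariant , valid-basisElem a λ′) , (sum (toList a) + sum λ′ , bounded) , symmetric
    where
    ∷ʳ-0-invariant : ∀ e → basisElem m ℓ a λ′ (e ++ [ 0 ]) ≈Q basisElem m ℓ a λ′ e
    ∷ʳ-0-invariant e = ≡⇒≈Q _ _ (basisElem-∷ʳ-0 m ℓ a λ′ e)
    bounded : ∀ e → sum (toList a) + sum λ′ < sum e → basisElem m ℓ a λ′ e ≈Q 0Q
    bounded e deg< = ≡⇒≈Q _ _ (basisElem-≡0Q a λ′ e (λ occ → ℕP.<-irrefl (sym (basisElem-degree a λ′ e occ)) deg<))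
    symmetric : SymmetricFrom m (basisElem m ℓ a λ′)
    symmetric N π fixes w = ≡⇒≈Q _ _ (begin
      basisElem m ℓ a λ′ (toList (permuteV π w))
        ≡⟨ basisElem≡indicator a λ′ (toList (permuteV π w)) ⟩
      indicator (occurs (toList a) λ′ (toList (headExponents m (toList (permuteV π w)))) (tailShape m (toList (permuteV π w))))
        ≡⟨ cong₂ (λ U c → indicator (occurs (toList a) λ′ (toList U) c))
                 (headExponents-permuteV m π fixes w) (tailShape-permuteV m π fixes w) ⟩
      indicator (occurs (toList a) λ′ (toList (headExponents m (toList w))) (tailShape m (toList w)))
        ≡⟨ basisElem≡indicator a λ′ (toList w) ⟨
      basisElem m ℓ a λ′ (toList w) ∎)
      where open ≡-Reasoning

  basisElem-canonical-self : ∀ a λ′ → IsPartition λ′ → basisElem m ℓ a λ′ (canonical (a , λ′)) ≡ 1Q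
  basisElem-canonical-self a λ′ P =
    trans (basisElem-canonical a λ′ a λ′ P) (cong indicator (occurs-self (toList a) λ′ P))

  basisElem-canonical-off : ∀ a λ′ a' μ → IsPartition μ → (a , λ′) ≢ (a' , μ) → ¬ (sum μ < sum λ′) →
    basisElem m ℓ a λ′ (canonical (a' , μ)) ≡ 0Q
  basisElem-canonical-off a λ′ a' μ P ne ≮ =
    trans (basisElem-canonical a λ′ a' μ P) (indicator≡0Q _ refl)
    where
    indicator≡0Q : ∀ b → occurs (toList a) λ′ (toList a') μ ≡ b → indicator b ≡ 0Q
    indicator≡0Q false _ = refl
    indicator≡0Q true occ with occurs-triangular (toList a) (toList a') λ′ μ P occ
    ... | inj₁ (a≡a' , λ′≡μ) = ⊥-elim (ne (cong₂ _,_ (toList-injective a a' a≡a') λ′≡μ))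
    ... | inj₂ lt = ⊥-elim (≮ lt)

  *Q-basisElem-canonical-off : ∀ c a λ′ a' μ → IsPartition μ → (a , λ′) ≢ (a' , μ) → ¬ (sum μ < sum λ′) →
    (c *Q basisElem m ℓ a λ′ (canonical (a' , μ))) ≈Q 0Q
  *Q-basisElem-canonical-off c a λ′ a' μ P ne ≮ =
    subst (λ z → (c *Q z) ≈Q 0Q) (sym (basisElem-canonical-off a λ′ a' μ P ne ≮)) (*Q-zeroʳ c)

  basisElem-canonicalise : ∀ a λ′ e →
    basisElem m ℓ a λ′ (canonical (headExponents m e , tailShape m e)) ≡ basisElem m ℓ a λ′ e
  basisElem-canonicalise a λ′ e = begin
    basisElem m ℓ a λ′ (canonical (U , tailShape m e))
      ≡⟨ basisElem-canonical a λ′ U (tailShape m e) (shape-partition (drop m e)) ⟩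
    indicator (occurs (toList a) λ′ (toList U) (tailShape m e))
      ≡⟨ basisElem≡indicator a λ′ e ⟨
    basisElem m ℓ a λ′ e ∎
    where open ≡-Reasoning
          U = headExponents m e

Entry : ℕ → Set
Entry m = QQ × Vec ℕ m × List ℕ

module Independence (m ℓ : ℕ) (ℓ-1≤m : ℓ ∸ 1 ≤ m) where
  open BasisElements m ℓ ℓ-1≤m
  open Values m ℓ ℓ-1≤m using (valid-basisElem)

  weight : Entry m → ℕ
  weight (_ , _ , λ′) = sum λ′

  totalWeight : List (Entry m) → ℕ
  totalWeight = foldr (λ x acc → weight x + acc) 0

  weight≤totalWeight : ∀ {x} L → x ∈ L → weight x ≤ totalWeight L
  weight≤totalWeight (y ∷ L) (here refl) = ℕP.m≤m+n (weight y) (totalWeight L)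
  weight≤totalWeight (y ∷ L) (there p) = ℕP.≤-trans (weight≤totalWeight L p) (ℕP.m≤n+m (totalWeight L) (weight y))

  module _ (L : LinComb m) (valid : ValidComb L) (distinct : Unique (indices L))
           (vanishes : evalComb (basisElem m ℓ) L ≋ zeroS) where

    -- Evaluating at the canonical monomial of x isolates the coefficient of x, once all
    -- coefficients of larger weight are known to vanish; the fuel n bounds the weights left.
    coefficient≈0Q : ∀ n x → x ∈ L → totalWeight L < n + weight x → proj₁ x ≈Q 0Q
    coefficient≈0Q zero x x∈ lt = ⊥-elim (ℕP.<⇒≱ lt (weight≤totalWeight L x∈))
    coefficient≈0Q (suc n) x@(c , a , λ′) x∈ lt =
      ≈Q-trans c (term x) 0Q (valid-term x x∈)
        (≈Q-sym (term x) c (subst (λ z → (c *Q z) ≈Q c) (sym (basisElem-canonical-self a λ′ λ′-partition)) (*Q-identityʳ c)))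
      (≈Q-trans (term x) (sumQ (map term L)) 0Q (valid-sumQ-map term L valid-term)
        (≈Q-sym (sumQ (map term L)) (term x) (sumQ-map-single term proj₂ L x x∈ distinct valid-term others-vanish))
        (vanishes (canonical (a , λ′))))
      where
      λ′-partition : IsPartition λ′
      λ′-partition = proj₂ (All.lookup valid x∈)
      term : Entry m → QQ
      term (c' , a' , λ'') = c' *Q basisElem m ℓ a' λ'' (canonical (a , λ′))
      valid-term : ∀ y → y ∈ L → ValidQ (term y)
      valid-term (c' , a' , λ'') y∈ =
        valid-*Q c' (basisElem m ℓ a' λ'' (canonical (a , λ′))) (proj₁ (All.lookup valid y∈)) (valid-basisElem a' λ'' (canonical (a , λ′)))
      others-vanish : ∀ y → y ∈ L → ¬ proj₂ y ≡ (a , λ′) → term y ≈Q 0Q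
      others-vanish (c' , a' , λ'') y∈ ne with sum λ′ ℕ.<? sum λ''
      ... | no ≮ = *Q-basisElem-canonical-off c' a' λ'' a λ′ λ′-partition ne ≮
      ... | yes heavier = ≈0Q⇒*Q≈0Q c' (basisElem m ℓ a' λ'' (canonical (a , λ′))) (coefficient≈0Q n (c' , a' , λ'') y∈
            (ℕP.<-≤-trans lt (subst (_≤ n + sum λ'') (ℕP.+-suc n (sum λ′)) (ℕP.+-monoʳ-≤ n heavier))))

    independent : All (λ { (c , _ , _) → c ≈Q 0Q }) L
    independent = All.tabulate (λ {x} x∈ →
      coefficient≈0Q (suc (totalWeight L)) x x∈ (s≤s (ℕP.m≤m+n (totalWeight L) (weight x))))

-- Elements of R_m are determined by their values at canonical monomials

liftBy : ∀ {n} (p : ℕ) → Permutation′ n → Permutation′ (p + n)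
liftBy zero σ = σ
liftBy (suc p) σ = lift₀ (liftBy p σ)

liftBy-fixes : ∀ {n} p (σ : Permutation′ n) (i : Fin (p + n)) → toℕ i < p → liftBy p σ ⟨$⟩ʳ i ≡ i
liftBy-fixes (suc p) σ fzero _ = refl
liftBy-fixes (suc p) σ (fsuc i) (s≤s lt) = cong fsuc (liftBy-fixes p σ i lt)

permuteV-liftBy : ∀ {p n} (pre : Vec ℕ p) (v : Vec ℕ n) (σ : Permutation′ n) →
  permuteV (liftBy p σ) (pre ++v v) ≡ pre ++v permuteV σ v
permuteV-liftBy []v v σ = refl
permuteV-liftBy (x ∷v pre) v σ = cong (x ∷v_) (permuteV-liftBy pre v σ)

swap₀₁ : ∀ {q} → Permutation′ (suc (suc q))
swap₀₁ = transpose fzero (fsuc fzero)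

permuteV-swap₀₁ : ∀ {q} x y (l : Vec ℕ q) → permuteV swap₀₁ (x ∷v y ∷v l) ≡ y ∷v x ∷v l
permuteV-swap₀₁ x y l = cong (λ z → y ∷v x ∷v z) (VecP.tabulate∘lookup l)

zeroCount : List ℕ → ℕ
zeroCount [] = 0
zeroCount (zero ∷ r) = suc (zeroCount r)
zeroCount (suc x ∷ r) = zeroCount r

↭-positives-zeros : ∀ r → r ↭ positives r ++ replicate (zeroCount r) 0
↭-positives-zeros [] = ↭.refl
↭-positives-zeros (zero ∷ r) =
  ↭.trans (↭.prep 0 (↭-positives-zeros r)) (↭-sym (↭P.shift 0 (positives r) (replicate (zeroCount r) 0)))
↭-positives-zeros (suc x ∷ r) = ↭.prep (suc x) (↭-positives-zeros r)

module SymmetricFunction (m : ℕ) (f : Series) (f∈R : InR m f) where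

  private
    f-∷ʳ-0 = proj₁ (proj₁ f∈R)
    valid-f = proj₂ (proj₁ f∈R)
    symmetric-f = proj₂ (proj₂ f∈R)

  cong-≈Q : ∀ {a b c d} → a ≡ c → b ≡ d → f a ≈Q f b → f c ≈Q f d
  cong-≈Q refl refl z = z

  value-swap : ∀ pre x y l → m ≤ length pre → f (pre ++ x ∷ y ∷ l) ≈Q f (pre ++ y ∷ x ∷ l)
  value-swap pre x y l m≤ = ≈Q-sym (f (pre ++ y ∷ x ∷ l)) (f (pre ++ x ∷ y ∷ l)) (cong-≈Q permuted original swapped)
    where
    P = fromList pre
    V = fromList l
    w = P ++v (x ∷v y ∷v V)
    π = liftBy (length pre) (swap₀₁ {length l})
    swapped : f (toList (permuteV π w)) ≈Q f (toList w)
    swapped = symmetric-f _ π (λ i lt → liftBy-fixes (length pre) swap₀₁ i (ℕP.<-≤-trans lt m≤)) w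
    permuted : toList (permuteV π w) ≡ pre ++ y ∷ x ∷ l
    permuted = trans (cong toList (trans (permuteV-liftBy P (x ∷v y ∷v V) swap₀₁) (cong (P ++v_) (permuteV-swap₀₁ x y V))))
      (trans (VecP.toList-++ P (y ∷v x ∷v V))
             (cong₂ (λ a b → a ++ y ∷ x ∷ b) (VecP.toList∘fromList pre) (VecP.toList∘fromList l)))
    original : toList w ≡ pre ++ x ∷ y ∷ l
    original = trans (VecP.toList-++ P (x ∷v y ∷v V))
      (cong₂ (λ a b → a ++ x ∷ y ∷ b) (VecP.toList∘fromList pre) (VecP.toList∘fromList l))

  value-↭ : ∀ {l l'} → l ↭ l' → ∀ pre → m ≤ length pre → f (pre ++ l) ≈Q f (pre ++ l')
  value-↭ {l} ↭.refl pre m≤ = ≈Q-refl (f (pre ++ l))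
  value-↭ {x ∷ l} {x ∷ l'} (↭.prep x p) pre m≤ =
    cong-≈Q (LP.++-assoc pre [ x ] l) (LP.++-assoc pre [ x ] l')
      (value-↭ p (pre ++ [ x ]) (ℕP.≤-trans m≤ (ℕP.≤-trans (ℕP.m≤m+n _ _) (ℕP.≤-reflexive (sym (LP.length-++ pre))))))
  value-↭ {x ∷ y ∷ l} {y ∷ x ∷ l'} (↭.swap x y p) pre m≤ =
    ≈Q-trans (f (pre ++ x ∷ y ∷ l)) (f (pre ++ y ∷ x ∷ l)) (f (pre ++ y ∷ x ∷ l')) (valid-f _) (value-swap pre x y l m≤)
      (cong-≈Q (LP.++-assoc pre (y ∷ [ x ]) l) (LP.++-assoc pre (y ∷ [ x ]) l')
        (value-↭ p (pre ++ y ∷ [ x ]) (ℕP.≤-trans m≤ (ℕP.≤-trans (ℕP.m≤m+n _ _) (ℕP.≤-reflexive (sym (LP.length-++ pre)))))))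
  value-↭ {l} {l''} (↭.trans {ys = l'} p q) pre m≤ =
    ≈Q-trans (f (pre ++ l)) (f (pre ++ l')) (f (pre ++ l'')) (valid-f _) (value-↭ p pre m≤) (value-↭ q pre m≤)

  value-++-replicate-0 : ∀ e j → f (e ++ replicate j 0) ≈Q f e
  value-++-replicate-0 e zero = cong-≈Q (sym (LP.++-identityʳ e)) refl (≈Q-refl (f e))
  value-++-replicate-0 e (suc j) = cong-≈Q (LP.++-assoc e [ 0 ] (replicate j 0)) refl
    (≈Q-trans (f ((e ++ [ 0 ]) ++ replicate j 0)) (f (e ++ [ 0 ])) (f e) (valid-f _)
      (value-++-replicate-0 (e ++ [ 0 ]) j) (f-∷ʳ-0 e))

  value-canonical : ∀ e → f e ≈Q f (canonical (headExponents m e , tailShape m e))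
  value-canonical e with headExponents-padding m e
  ... | j , eq =
    ≈Q-trans (f e) (f (e ++ replicate j 0)) (f (U ++ tailShape m e)) (valid-f _)
      (≈Q-sym (f (e ++ replicate j 0)) (f e) (value-++-replicate-0 e j))
    (cong-≈Q (sym eq) refl
    (≈Q-trans (f (U ++ r)) (f (U ++ (tailShape m e ++ replicate (zeroCount r) 0))) (f (U ++ tailShape m e)) (valid-f _)
      (value-↭ (↭.trans (↭-positives-zeros r) (↭P.++⁺ʳ (replicate (zeroCount r) 0) (↭-sym (sortDesc-↭ (positives r)))))
               U (ℕP.≤-reflexive (sym (VecP.length-toList (headExponents m e)))))
      (cong-≈Q (LP.++-assoc U (tailShape m e) (replicate (zeroCount r) 0)) refl
               (value-++-replicate-0 (U ++ tailShape m e) (zeroCount r)))))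
    where
    U = toList (headExponents m e)
    r = drop m e

-- Finitely many indices of bounded degree

vectorsBelow : (m D : ℕ) → List (Vec ℕ m)
vectorsBelow zero D = [ []v ]
vectorsBelow (suc m) D = concatMap (λ x → map (x ∷v_) (vectorsBelow m D)) (upTo (suc D))

∈-vectorsBelow : ∀ m D (a : Vec ℕ m) → All (_≤ D) (toList a) → a ∈ vectorsBelow m D
∈-vectorsBelow zero D []v _ = here refl
∈-vectorsBelow (suc m) D (x ∷v a) (x≤D ∷ a≤D) =
  MP.∈-concatMap⁺ (λ x → map (x ∷v_) (vectorsBelow m D))
    (Any.map (λ { refl → MP.∈-map⁺ (x ∷v_) (∈-vectorsBelow m D a a≤D) }) (MP.∈-upTo⁺ (s≤s x≤D)))

listsBelow : (n D : ℕ) → List (List ℕ)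
listsBelow zero D = [ [] ]
listsBelow (suc n) D = [] ∷ concatMap (λ x → map (x ∷_) (listsBelow n D)) (upTo (suc D))

∈-listsBelow : ∀ n D (l : List ℕ) → length l ≤ n → All (_≤ D) l → l ∈ listsBelow n D
∈-listsBelow zero D [] _ _ = here refl
∈-listsBelow (suc n) D [] _ _ = here refl
∈-listsBelow (suc n) D (x ∷ l) (s≤s |l|≤n) (x≤D ∷ l≤D) =
  there (MP.∈-concatMap⁺ (λ x → map (x ∷_) (listsBelow n D))
    (Any.map (λ { refl → MP.∈-map⁺ (x ∷_) (∈-listsBelow n D l |l|≤n l≤D) }) (MP.∈-upTo⁺ (s≤s x≤D))))

All-≤-sum : ∀ (l : List ℕ) → All (_≤ sum l) l
All-≤-sum [] = []
All-≤-sum (x ∷ l) = ℕP.m≤m+n x (sum l) ∷ All.map (λ le → ℕP.≤-trans le (ℕP.m≤n+m (sum l) x)) (All-≤-sum l)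

All-≤-weaken : ∀ {l : List ℕ} {a b} → a ≤ b → All (_≤ a) l → All (_≤ b) l
All-≤-weaken a≤b = All.map (λ p → ℕP.≤-trans p a≤b)

length≤sum : ∀ (l : List ℕ) → All (0 <_) l → length l ≤ sum l
length≤sum [] _ = z≤n
length≤sum (x ∷ l) (p ∷ ps) = ℕP.+-mono-≤ p (length≤sum l ps)

Index : ℕ → Set
Index m = Vec ℕ m × List ℕ

IndexOfDegree≤ : ∀ m → ℕ → Index m → Set
IndexOfDegree≤ m D (a , λ′) = IsPartition λ′ × (sum (toList a) + sum λ′ ≤ D)

indexOfDegree≤? : ∀ m D x → Dec (IndexOfDegree≤ m D x)
indexOfDegree≤? m D (a , λ′) =
  ((all? (λ n → 0 ℕ.<? n) λ′) ×-dec (linked? (λ x y → y ℕ.≤? x) λ′)) ×-dec ((sum (toList a) + sum λ′) ℕ.≤? D)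

_≟ᴵ_ : ∀ {m} (x y : Index m) → Dec (x ≡ y)
_≟ᴵ_ = ProdP.≡-dec (VecP.≡-dec ℕ._≟_) (LP.≡-dec ℕ._≟_)

indicesOfDegree≤ : ∀ m → ℕ → List (Index m)
indicesOfDegree≤ m D =
  deduplicate _≟ᴵ_ (filter (indexOfDegree≤? m D) (cartesianProduct (vectorsBelow m D) (listsBelow D D)))

indicesOfDegree≤-unique : ∀ m D → Unique (indicesOfDegree≤ m D)
indicesOfDegree≤-unique m D =
  UniqueDecP.deduplicate-! _≟ᴵ_ (filter (indexOfDegree≤? m D) (cartesianProduct (vectorsBelow m D) (listsBelow D D)))

∈indicesOfDegree≤⁻ : ∀ m D x → x ∈ indicesOfDegree≤ m D → IndexOfDegree≤ m D x
∈indicesOfDegree≤⁻ m D x x∈ =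
  proj₂ (MP.∈-filter⁻ (indexOfDegree≤? m D) {xs = cartesianProduct (vectorsBelow m D) (listsBelow D D)}
    (MP.∈-deduplicate⁻ _≟ᴵ_ (filter (indexOfDegree≤? m D) (cartesianProduct (vectorsBelow m D) (listsBelow D D))) x∈))

∈indicesOfDegree≤⁺ : ∀ m D x → IndexOfDegree≤ m D x → x ∈ indicesOfDegree≤ m D
∈indicesOfDegree≤⁺ m D (a , λ′) ok@((pos , _) , deg≤) =
  MP.∈-deduplicate⁺ _≟ᴵ_ (MP.∈-filter⁺ (indexOfDegree≤? m D)
    (MP.∈-cartesianProduct⁺
      (∈-vectorsBelow m D a (All-≤-weaken (ℕP.≤-trans (ℕP.m≤m+n _ _) deg≤) (All-≤-sum (toList a))))
      (∈-listsBelow D D λ′ (ℕP.≤-trans (length≤sum λ′ pos) (ℕP.≤-trans (ℕP.m≤n+m _ _) deg≤))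
                           (All-≤-weaken (ℕP.≤-trans (ℕP.m≤n+m _ _) deg≤) (All-≤-sum λ′))))
    ok)

-- The coefficients are found one weight level at a time, from the top degree of f down: at
-- each level, the residual of f at the canonical monomial of an index is its new coefficient.
module Spanning (m ℓ : ℕ) (ℓ-1≤m : ℓ ∸ 1 ≤ m) (f : Series) (f∈R : InR m f) where
  open Values m ℓ ℓ-1≤m using (valid-basisElem; basisElem-≡0Q)
  open BasisElements m ℓ ℓ-1≤m
  open SymmetricFunction m f f∈R using (value-canonical)

  private
    valid-f = proj₂ (proj₁ f∈R)
    D = proj₁ (proj₁ (proj₂ f∈R))
    f-bounded = proj₂ (proj₁ (proj₂ f∈R))

  I : List (Index m)
  I = indicesOfDegree≤ m D

  weight : Index m → ℕ
  weight (_ , μ) = sum μ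

  weight≤D : ∀ j → j ∈ I → weight j ≤ D
  weight≤D j j∈ = ℕP.≤-trans (ℕP.m≤n+m (weight j) _) (proj₂ (∈indicesOfDegree≤⁻ m D j j∈))

  partition : ∀ j → j ∈ I → IsPartition (proj₂ j)
  partition j j∈ = proj₁ (∈indicesOfDegree≤⁻ m D j j∈)

  evalAt : List (Entry m) → Mono → QQ
  evalAt = evalComb (basisElem m ℓ)

  term : Mono → Entry m → QQ
  term e (c , a , λ′) = c *Q basisElem m ℓ a λ′ e

  Supported : List (Entry m) → Set
  Supported = All (λ y → ValidQ (proj₁ y) × proj₂ y ∈ I)

  valid-term : ∀ e y → ValidQ (proj₁ y) → ValidQ (term e y)
  valid-term e (c , a , λ′) c≉ = valid-*Q c (basisElem m ℓ a λ′ e) c≉ (valid-basisElem a λ′ e)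

  valid-evalAt : ∀ L → Supported L → ∀ e → ValidQ (evalAt L e)
  valid-evalAt L ok e = valid-sumQ-map (term e) L (λ y y∈ → valid-term e y (proj₁ (All.lookup ok y∈)))

  evalAt-++ : ∀ L L' → Supported L → Supported L' → ∀ e → evalAt (L ++ L') e ≈Q (evalAt L e +Q evalAt L' e)
  evalAt-++ L L' ok ok' e =
    subst (λ z → sumQ z ≈Q (evalAt L e +Q evalAt L' e)) (sym (LP.map-++ (term e) L L'))
      (sumQ-++ (map (term e) L) (map (term e) L') (validAll L ok) (validAll L' ok'))
    where
    validAll : ∀ L → Supported L → All ValidQ (map (term e) L)
    validAll L ok = AllP.map⁺ (All.map (λ {y} o → valid-term e y (proj₁ o)) ok)

  residual : List (Entry m) → Index m → QQ
  residual L i = f (canonical i) +Q negQ (evalAt L (canonical i))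

  valid-residual : ∀ L → Supported L → ∀ i → ValidQ (residual L i)
  valid-residual L ok i = valid-+Q (f (canonical i)) (negQ (evalAt L (canonical i))) (valid-f _)
    (valid-negQ (evalAt L (canonical i)) (valid-evalAt L ok (canonical i)))

  level : ℕ → List (Index m)
  level n = filter (λ i → weight i ℕ.≟ n) I

  ∈level⁻ : ∀ {n i} → i ∈ level n → i ∈ I × weight i ≡ n
  ∈level⁻ {n} = MP.∈-filter⁻ (λ i → weight i ℕ.≟ n) {xs = I}

  nextLevel : List (Entry m) → ℕ → List (Entry m)
  nextLevel L n = map (λ i → residual L i , i) (level n)

  module _ (L : List (Entry m)) (L-supported : Supported L) (n : ℕ) (j : Index m) (j∈ : j ∈ I) where

    levelTerm : Index m → QQ
    levelTerm i = residual L i *Q basisElem m ℓ (proj₁ i) (proj₂ i) (canonical j)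

    evalAt-nextLevel : evalAt (nextLevel L n) (canonical j) ≡ sumQ (map levelTerm (level n))
    evalAt-nextLevel = cong sumQ (sym (LP.map-∘ (level n)))

    valid-levelTerm : ∀ i → i ∈ level n → ValidQ (levelTerm i)
    valid-levelTerm i _ =
      valid-*Q (residual L i) (basisElem m ℓ (proj₁ i) (proj₂ i) (canonical j)) (valid-residual L L-supported i) (valid-basisElem (proj₁ i) (proj₂ i) (canonical j))

    levelTerm-off : n ≤ weight j → ∀ i → i ∈ level n → i ≢ j → levelTerm i ≈Q 0Q
    levelTerm-off n≤ i@(a , λ′) i∈ i≢j = *Q-basisElem-canonical-off (residual L i) a λ′ (proj₁ j) (proj₂ j)
      (partition j j∈) i≢j (λ lt → ℕP.<⇒≱ lt (subst (_≤ weight j) (sym (proj₂ (∈level⁻ i∈))) n≤))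

    nextLevel-on : weight j ≡ n → evalAt (nextLevel L n) (canonical j) ≈Q residual L j
    nextLevel-on refl =
      subst (_≈Q residual L j) (sym evalAt-nextLevel)
      (≈Q-trans (sumQ (map levelTerm (level n))) (levelTerm j) (residual L j) (valid-levelTerm j j∈level)
        (sumQ-map-single levelTerm (λ i → i) (level n) j j∈level
          (subst Unique (sym (LP.map-id (level n))) (UniqueP.filter⁺ (λ i → weight i ℕ.≟ n) (indicesOfDegree≤-unique m D)))
          valid-levelTerm (λ i i∈ → levelTerm-off ℕP.≤-refl i i∈))
        (subst (λ z → (residual L j *Q z) ≈Q residual L j)
               (sym (basisElem-canonical-self (proj₁ j) (proj₂ j) (partition j j∈))) (*Q-identityʳ (residual L j))))
      where
      j∈level : j ∈ level n
      j∈level = MP.∈-filter⁺ (λ i → weight i ℕ.≟ n) j∈ refl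

    nextLevel-off : n ≤ weight j → weight j ≢ n → evalAt (nextLevel L n) (canonical j) ≈Q 0Q
    nextLevel-off n≤ w≢n = subst (_≈Q 0Q) (sym evalAt-nextLevel)
      (sumQ-map-≈0Q levelTerm (level n) (λ i i∈ → levelTerm-off n≤ i i∈
        (λ { refl → w≢n (proj₂ (∈level⁻ i∈)) })))

  approximation : ℕ → List (Entry m)
  approximation zero = []
  approximation (suc k) = approximation k ++ nextLevel (approximation k) (D ∸ k)

  supported-nextLevel : ∀ k → Supported (approximation k) → Supported (nextLevel (approximation k) (D ∸ k))
  supported-nextLevel k ok = AllP.map⁺ (All.tabulate (λ {i} i∈ →
    valid-residual (approximation k) ok i , proj₁ (∈level⁻ i∈)))

  supported-approximation : ∀ k → Supported (approximation k)
  supported-approximation zero = []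
  supported-approximation (suc k) =
    AllP.++⁺ (supported-approximation k) (supported-nextLevel k (supported-approximation k))

  module Step (k : ℕ) (j : Index m) where
    L = approximation k
    N = nextLevel L (D ∸ k)
    L-supported = supported-approximation k
    N-supported = supported-nextLevel k L-supported
    e = canonical j

    valid-split : ValidQ (evalAt L e +Q evalAt N e)
    valid-split = valid-+Q (evalAt L e) (evalAt N e) (valid-evalAt L L-supported e) (valid-evalAt N N-supported e)

    evalAt-split : evalAt (L ++ N) e ≈Q (evalAt L e +Q evalAt N e)
    evalAt-split = evalAt-++ L N L-supported N-supported e

  approximation-agrees : ∀ k j → j ∈ I → D < k + weight j → evalAt (approximation k) (canonical j) ≈Q f (canonical j)
  approximation-agrees zero j j∈ lt = ⊥-elim (ℕP.<⇒≱ lt (weight≤D j j∈))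
  approximation-agrees (suc k) j j∈ lt with weight j ℕ.≟ D ∸ k
  ... | yes w≡n =
    ≈Q-trans (evalAt (L ++ N) e) (evalAt L e +Q evalAt N e) (f e) valid-split evalAt-split
      (≈Q-trans (evalAt L e +Q evalAt N e) (evalAt L e +Q residual L j) (f e)
        (valid-+Q (evalAt L e) (residual L j) (valid-evalAt L L-supported e) (valid-residual L L-supported j))
        (+Q-cong (evalAt L e) (evalAt L e) (evalAt N e) (residual L j) (≈Q-refl (evalAt L e))
                 (nextLevel-on L L-supported (D ∸ k) j j∈ w≡n))
        (+Q-negQ-cancelˡ (evalAt L e) (f e) (valid-evalAt L L-supported e) (valid-f e)))
    where open Step k j
  ... | no w≢n =
    ≈Q-trans (evalAt (L ++ N) e) (evalAt L e +Q evalAt N e) (f e) valid-split evalAt-split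
      (≈Q-trans (evalAt L e +Q evalAt N e) (evalAt L e) (f e) (valid-evalAt L L-supported e)
        (+Q-≈0Q (evalAt L e) (evalAt N e) (valid-evalAt L L-supported e)
                (nextLevel-off L L-supported (D ∸ k) j j∈ n≤w w≢n))
        (approximation-agrees k j j∈ lt'))
    where
    open Step k j
    lt' : D < k + weight j
    lt' with ℕP.m≤n⇒m<n∨m≡n (ℕP.≤-pred lt)
    ... | inj₁ D< = D<
    ... | inj₂ D≡ = ⊥-elim (w≢n (sym (trans (cong (_∸ k) D≡) (ℕP.m+n∸m≡n k (weight j)))))
    n≤w : D ∸ k ≤ weight j
    n≤w = subst (D ∸ k ≤_) (ℕP.m+n∸m≡n k (weight j)) (ℕP.∸-monoˡ-≤ k (ℕP.<⇒≤ lt'))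

  expansion : LinComb m
  expansion = approximation (suc D)

  valid-expansion : ValidComb expansion
  valid-expansion = All.map (λ {y} o → proj₁ o , partition (proj₂ y) (proj₂ o)) (supported-approximation (suc D))

  f≋expansion : f ≋ evalAt expansion
  f≋expansion e with sum e ℕ.≤? D
  ... | yes deg≤ =
    ≈Q-trans (f e) (f (canonical j)) (evalAt expansion e) (valid-f _) (value-canonical e)
      (≈Q-trans (f (canonical j)) (evalAt expansion (canonical j)) (evalAt expansion e)
        (valid-evalAt expansion (supported-approximation (suc D)) (canonical j))
        (≈Q-sym (evalAt expansion (canonical j)) (f (canonical j))
          (approximation-agrees (suc D) j j∈ (s≤s (ℕP.m≤m+n D (weight j)))))
        (≡⇒≈Q (evalAt expansion (canonical j)) (evalAt expansion e)
          (cong sumQ (LP.map-cong (λ { (c , a , λ′) → cong (c *Q_) (basisElem-canonicalise a λ′ e) }) expansion))))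
    where
    j : Index m
    j = headExponents m e , tailShape m e
    j∈ : j ∈ I
    j∈ = ∈indicesOfDegree≤⁺ m D j (shape-partition (drop m e) , subst (_≤ D) (sum-headExponents-tailShape m e) deg≤)
  ... | no deg> =
    ≈Q-trans (f e) 0Q (evalAt expansion e) valid-0Q (f-bounded e (ℕP.≰⇒> deg>))
      (≈Q-sym (evalAt expansion e) 0Q (sumQ-map-≈0Q (term e) expansion (λ y y∈ →
        term-vanishes y (proj₂ (All.lookup (supported-approximation (suc D)) y∈)))))
    where
    term-vanishes : ∀ y → proj₂ y ∈ I → term e y ≈Q 0Q
    term-vanishes (c , a , λ′) i∈ =
      subst (λ z → (c *Q z) ≈Q 0Q)
        (sym (basisElem-≡0Q a λ′ e (λ occ → deg> (subst (_≤ D) (sym (basisElem-degree a λ′ e occ))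
                                                  (proj₂ (∈indicesOfDegree≤⁻ m D (a , λ′) i∈))))))
        (*Q-zeroʳ c)

proposition3p1 : ∀ (m ℓ : ℕ) → 1 ≤ ℓ → ℓ ≤ suc m → IsBasisR m (basisElem m ℓ)
proposition3p1 m ℓ _ ℓ≤1+m =
    BasisElements.basisElem∈R m ℓ ℓ-1≤m
  , Independence.independent m ℓ ℓ-1≤m
  , λ f f∈R → let open Spanning m ℓ ℓ-1≤m f f∈R in expansion , valid-expansion , f≋expansion
  where
  ℓ-1≤m : ℓ ∸ 1 ≤ m
  ℓ-1≤m = ℕP.∸-monoˡ-≤ 1 ℓ≤1+m
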